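{- Let $T$ be a tree with $n\ge 4$ vertices that is 2-distant (a lobster), and suppose $T$ has a perfect matching $M$ such that $M$ is exactly the set of end edges of $T$ (edges incident to a vertex of degree $1$). Let $P=v_0,v_1,v_2,\dots,v_p$ be a path in $T$ of maximal length among all paths $Q$ in $T$ with the property that every vertex of $T$ is at distance at most $2$ from some vertex of $Q$. Let $u_2$ be the vertex with $v_2u_2\in M$. Then there exist strongly graceful labellings $f,f_1,f_2,f_3$ of $T$ (with respect to $M$) such that $f(v_0)=0$, $f_1(v_1)=0$, $f_2(v_2)=0$ and $f_3(u_2)=0$.
   Context: A tree $T$ is $k$-distant if it contains a path $P$ such that every vertex of $T$ is at distance at most $k$ from a vertex of $P$; 2-distant trees are called lobsters. A graceful labelling of a tree $T$ is a bijection $f:V(T)\to\{0,1,\dots,|E(T)|\}$ such that the induced edge labels $|f(u)-f(v)|$ ($uv\in E(T)$) are pairwise distinct (equivalently, are exactly $1,\dots,|E(T)|$). If $T$ has a perfect matching $M$, a strongly graceful labelling of $T$ is a graceful labelling $f$ such that $f(x)+f(y)=|V(T)|-1$ for every edge $xy\in M$. -}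

module Defs where

open import Data.Nat using (ℕ; zero; suc; _≤_; _∸_; _+_; ∣_-_∣)
open import Data.Fin using (Fin; toℕ)
open import Data.List using (List; []; _∷_; length)
open import Data.List.Membership.Propositional using (_∈_)
open import Data.List.Relation.Unary.Unique.Propositional using (Unique)
open import Data.Product using (Σ; ∃; _×_; _,_)
open import Data.Sum using (_⊎_)
open import Data.Empty using (⊥)
open import Relation.Nullary using (¬_)
open import Relation.Binary.PropositionalEquality using (_≡_)
open import Function.Definitions using (Bijective)

record Graph (n : ℕ) : Set₁ where
  field
    Adj    : Fin n → Fin n → Set
    sym    : ∀ {u v} → Adj u v → Adj v u
    irrefl : ∀ {u} → ¬ Adj u u
open Graph public

module _ {n : ℕ} (G : Graph n) where

  data Walk : Fin n → Fin n → ℕ → Set where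
    here : ∀ {u} → Walk u u 0
    step : ∀ {u w v k} → Adj G u w → Walk w v k → Walk u v (suc k)

  DistLE : Fin n → Fin n → ℕ → Set
  DistLE u v k = Σ ℕ λ j → j ≤ k × Walk u v j

  Connected : Set
  Connected = ∀ u v → Σ ℕ λ k → Walk u v k

  Chain : List (Fin n) → Set
  Chain []           = ⊥
  Chain (x ∷ [])     = Data.Unit.⊤ where import Data.Unit
  Chain (x ∷ y ∷ xs) = Adj G x y × Chain (y ∷ xs)

  IsPath : List (Fin n) → Set
  IsPath P = Chain P × Unique P

  IsCycle : List (Fin n) → Set
  IsCycle []           = ⊥
  IsCycle (x ∷ [])     = ⊥
  IsCycle (x ∷ y ∷ []) = ⊥
  IsCycle (x ∷ y ∷ z ∷ xs) =
    IsPath (x ∷ y ∷ z ∷ xs) × Adj G (last z xs) x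
    where
      last : Fin n → List (Fin n) → Fin n
      last a []       = a
      last a (b ∷ bs) = last b bs

  Acyclic : Set
  Acyclic = ∀ C → ¬ IsCycle C

  IsTree : Set
  IsTree = Connected × Acyclic

  KDominating : ℕ → List (Fin n) → Set
  KDominating k Q = ∀ v → Σ (Fin n) λ w → w ∈ Q × DistLE v w k

  KDistant : ℕ → Set
  KDistant k = Σ (List (Fin n)) λ Q → IsPath Q × KDominating k Q

  Lobster : Set
  Lobster = KDistant 2

  Leaf : Fin n → Set
  Leaf v = Σ (Fin n) λ w → Adj G v w × (∀ x → Adj G v x → x ≡ w)

  EndEdge : Fin n → Fin n → Set
  EndEdge u v = Adj G u v × (Leaf u ⊎ Leaf v)

  IsPerfectMatching : (Fin n → Fin n → Set) → Set
  IsPerfectMatching M =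
    (∀ u v → M u v → Adj G u v) ×
    (∀ u v → M u v → M v u) ×
    (∀ v → Σ (Fin n) λ u → M v u × (∀ w → M v w → w ≡ u))

  -- Graceful labelling of a TREE on n vertices (so |E| = n ∸ 1):
  -- a bijection V → {0,…,n-1} = Fin n with pairwise distinct edge labels.
  Graceful : (Fin n → Fin n) → Set
  Graceful f =
    Bijective _≡_ _≡_ f ×
    (∀ u v x y → Adj G u v → Adj G x y →
       ∣ toℕ (f u) - toℕ (f v) ∣ ≡ ∣ toℕ (f x) - toℕ (f y) ∣ →
       (u ≡ x × v ≡ y) ⊎ (u ≡ y × v ≡ x))

  StronglyGraceful : (Fin n → Fin n → Set) → (Fin n → Fin n) → Set
  StronglyGraceful M f =
    Graceful f × (∀ x y → M x y → toℕ (f x) + toℕ (f y) ≡ n ∸ 1)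

-- Contract every matching edge to its endpoint nearer the root r. As each
-- matching edge contains a leaf, the contracted tree on the m = n/2 upper
-- endpoints is a caterpillar along the longest 2-dominating path, and the usual
-- labelling of a caterpillar (walk it level by level, numbering one colour
-- class upwards from 0 and the other downwards from m - 1) is graceful with
-- r ↦ 0. Doubling it on the upper endpoints and giving each lower endpoint
-- n - 1 minus its partner's value is strongly graceful: contracted edges get
-- the even labels, matching edges the odd ones. Rooting at v₁ and at v₂ gives
-- f₁ and f₂; reflecting them (i ↦ n - 1 - i) gives f and f₃, since v₀ and u₂
-- are the partners of v₁ and v₂.

module Submission where

open import Defs hiding (sym)
open import Data.Bool using (Bool; true; false; not)
import Data.Bool.Properties as BoolP
open import Data.Empty using (⊥; ⊥-elim)
open import Data.Fin using (Fin; toℕ; _≟_; opposite; punchOut; fromℕ<)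
import Data.Fin as Fin
import Data.Fin.Properties as FinP
open import Data.List using (List; []; _∷_; length; _++_; reverse; reverseAcc)
import Data.List.Properties as ListP
open import Data.List.Membership.Propositional using (_∈_; _∉_)
open import Data.List.Membership.Propositional.Properties using (∈-∃++; ∈-++⁺ˡ)
open import Data.List.Relation.Unary.Any using (here; there)
import Data.List.Relation.Unary.Any.Properties as AnyP
open import Data.List.Relation.Unary.All using ([])
open import Data.List.Relation.Unary.All.Properties using (¬Any⇒All¬; ++⁻ˡ)
open import Data.List.Relation.Unary.AllPairs using ([]; _∷_)
open import Data.List.Relation.Unary.Unique.Propositional using (Unique)
open import Data.List.Relation.Unary.Unique.Propositional.Properties using (Unique[x∷xs]⇒x∉xs)
open import Data.Nat using (ℕ; zero; suc; _+_; _∸_; _*_; _<_; _≤_; z≤n; s≤s; ∣_-_∣; >-nonZero)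
open import Data.Nat.Divisibility using (_∣_; ∣m∸n∣n⇒∣m; ∣m+n∣m⇒∣n; ∣m∣n⇒∣m+n; ∣1⇒≡1; m∣m*n)
import Data.Nat.Properties as ℕP
open import Data.Product using (Σ; _×_; _,_; proj₁; proj₂)
open import Data.Sum using (_⊎_; inj₁; inj₂)
import Data.Sum as Sum
open import Data.Unit using (tt)
open import Function.Bundles using (_⇔_; Equivalence)
open import Function.Base using (_$_; _∘′_)
open import Function.Definitions using (Injective; Surjective)
open import Relation.Binary using (tri<; tri≈; tri>)
open import Relation.Binary.PropositionalEquality
  using (_≡_; _≢_; refl; sym; trans; cong; cong₂; subst; subst₂; module ≡-Reasoning)
open import Relation.Nullary using (¬_; Dec; yes; no)
open import Relation.Nullary.Decidable using (_⊎-dec_; _×-dec_; ¬?)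

module _ {A : Set} where

  lastFrom : A → List A → A
  lastFrom a []       = a
  lastFrom a (b ∷ bs) = lastFrom b bs

  firstOr : A → List A → A
  firstOr a []      = a
  firstOr a (b ∷ _) = b

  lastFrom-∷ʳ : ∀ a xs b → lastFrom a (xs ++ b ∷ []) ≡ b
  lastFrom-∷ʳ a []       b = refl
  lastFrom-∷ʳ a (x ∷ xs) b = lastFrom-∷ʳ x xs b

  lastFrom-∈ : ∀ a xs → lastFrom a xs ≡ a ⊎ lastFrom a xs ∈ xs
  lastFrom-∈ a []       = inj₁ refl
  lastFrom-∈ a (b ∷ bs) with lastFrom-∈ b bs
  ... | inj₁ e = inj₂ (here e)
  ... | inj₂ m = inj₂ (there m)

  Unique-∷ : ∀ {x : A} {xs} → x ∉ xs → Unique xs → Unique (x ∷ xs)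
  Unique-∷ {xs = xs} x∉ u = ¬Any⇒All¬ xs x∉ ∷ u

  Unique-tail : ∀ {x : A} {xs} → Unique (x ∷ xs) → Unique xs
  Unique-tail (_ ∷ u) = u

  Unique-++⁻ˡ : ∀ xs {ys : List A} → Unique (xs ++ ys) → Unique xs
  Unique-++⁻ˡ []       _        = []
  Unique-++⁻ˡ (x ∷ xs) (p ∷ ps) = ++⁻ˡ xs p ∷ Unique-++⁻ˡ xs ps

  ∷-injective-at-length : ∀ {x y : A} xs ys xs′ ys′ →
    xs ++ x ∷ ys ≡ xs′ ++ y ∷ ys′ → length xs ≡ length xs′ → x ≡ y
  ∷-injective-at-length []       ys []        ys′ refl _ = refl
  ∷-injective-at-length (_ ∷ xs) ys (_ ∷ xs′) ys′ e l =
    ∷-injective-at-length xs ys xs′ ys′ (ListP.∷-injectiveʳ e) (ℕP.suc-injective l)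

module _ {n} (G : Graph n) where

  IsPath-tail : ∀ {a x p} → IsPath G (a ∷ x ∷ p) → IsPath G (x ∷ p)
  IsPath-tail ((_ , c) , u) = c , Unique-tail u

  Chain-++⁻ˡ : ∀ xs {y} ys → Chain G (xs ++ y ∷ ys) → Chain G (xs ++ y ∷ [])
  Chain-++⁻ˡ []           ys c       = tt
  Chain-++⁻ˡ (u ∷ [])     ys (a , c) = a , tt
  Chain-++⁻ˡ (u ∷ v ∷ xs) ys (a , c) = a , Chain-++⁻ˡ (v ∷ xs) ys c

  IsPath-++⁻ˡ : ∀ xs {y} ys → IsPath G (xs ++ y ∷ ys) → IsPath G (xs ++ y ∷ [])
  IsPath-++⁻ˡ xs {y} ys (c , u) = Chain-++⁻ˡ xs ys c ,
    Unique-++⁻ˡ (xs ++ y ∷ []) (subst Unique (sym (ListP.++-assoc xs (y ∷ []) ys)) u)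

  Chain-reverseAcc : ∀ x acc xs → Chain G (x ∷ acc) → Chain G (x ∷ xs) → Chain G (reverseAcc (x ∷ acc) xs)
  Chain-reverseAcc x acc []       c₁ c₂       = c₁
  Chain-reverseAcc x acc (y ∷ ys) c₁ (a , c₂) = Chain-reverseAcc y (x ∷ acc) ys (Graph.sym G a , c₁) c₂

  Chain-reverse : ∀ xs → Chain G xs → Chain G (reverse xs)
  Chain-reverse (x ∷ xs) = Chain-reverseAcc x [] xs tt

Leaf⇒≡ : ∀ {n} (G : Graph n) {x y z} → Leaf G x → Adj G x y → Adj G x z → y ≡ z
Leaf⇒≡ G (_ , _ , only) xy xz = trans (only _ xy) (sym (only _ xz))

Chain-mono : ∀ {n} {G G′ : Graph n} → (∀ {u v} → Adj G u v → Adj G′ u v) → ∀ xs → Chain G xs → Chain G′ xs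
Chain-mono f (x ∷ [])     c       = tt
Chain-mono f (x ∷ y ∷ xs) (a , c) = f a , Chain-mono f (y ∷ xs) c

addEdge : ∀ {n} (G : Graph n) (a b : Fin n) → a ≢ b → Graph n
addEdge G a b a≢b = record
  { Adj    = λ u v → Adj G u v ⊎ ((u ≡ a × v ≡ b) ⊎ (u ≡ b × v ≡ a))
  ; sym    = λ { (inj₁ e) → inj₁ (Graph.sym G e)
               ; (inj₂ (inj₁ (p , q))) → inj₂ (inj₂ (q , p))
               ; (inj₂ (inj₂ (p , q))) → inj₂ (inj₁ (q , p)) }
  ; irrefl = λ { (inj₁ e) → irrefl G e
               ; (inj₂ (inj₁ (refl , q))) → a≢b q
               ; (inj₂ (inj₂ (refl , q))) → a≢b (sym q) } }

-- The closing edge of a cycle is stated through a function local to Defs, so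
-- we recurse on the path length by shortcutting x y z b … to x y b … with a
-- chord y b, which lives only in an enlarged graph.
IsPath⇒IsCycle : ∀ {n} (G : Graph n) x y z xs → IsPath G (x ∷ y ∷ z ∷ xs) → Adj G (lastFrom z xs) x →
                 IsCycle G (x ∷ y ∷ z ∷ xs)
IsPath⇒IsCycle G x y z [] p a = p , a
IsPath⇒IsCycle {n} G x y z (b ∷ bs) ((xy , yz , zb , c) , u@(_ ∷ _ ∷ _ ∷ ub)) a
  with proj₂ (IsPath⇒IsCycle G′ x y b bs (chain′ , unique′) (inj₁ a))
  where
  y≢b : y ≢ b
  y≢b = Unique[x∷xs]⇒x∉xs (Unique-tail u) ∘′ there ∘′ here
  G′ : Graph n
  G′ = addEdge G y b y≢b
  chain′ : Chain G′ (x ∷ y ∷ b ∷ bs)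
  chain′ = inj₁ xy , inj₂ (inj₁ (refl , refl)) , Chain-mono inj₁ (b ∷ bs) c
  unique′ : Unique (x ∷ y ∷ b ∷ bs)
  unique′ = Unique-∷ (λ { (here e) → Unique[x∷xs]⇒x∉xs u (here e)
                        ; (there m) → Unique[x∷xs]⇒x∉xs u (there (there m)) })
                     (Unique-∷ (λ m → Unique[x∷xs]⇒x∉xs (Unique-tail u) (there m)) ub)
... | inj₁ e                = ((xy , yz , zb , c) , u) , e
... | inj₂ (inj₂ (_ , x≡y)) = ⊥-elim (Unique[x∷xs]⇒x∉xs u (here x≡y))
... | inj₂ (inj₁ (_ , x≡b)) = ⊥-elim (Unique[x∷xs]⇒x∉xs u (there (there (here x≡b))))

module Tree {n} (G : Graph n) (acyclic : Acyclic G) where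
  open import Data.List.Membership.DecPropositional (_≟_ {n}) using (_∈?_)

  no-chord : ∀ {a x p y} → IsPath G (a ∷ x ∷ p) → y ∈ p → ¬ Adj G y a
  no-chord {a} {x} P y∈p ya with ∈-∃++ y∈p
  ... | p₁ , p₂ , refl with p₁ | IsPath-++⁻ˡ G (a ∷ x ∷ p₁) p₂ P
  ...   | []      | P′ = acyclic (a ∷ x ∷ _ ∷ []) (P′ , ya)
  ...   | w ∷ p₁′ | P′ = acyclic _ (IsPath⇒IsCycle G a x w (p₁′ ++ _ ∷ []) P′
                            (subst (λ t → Adj G t a) (sym (lastFrom-∷ʳ w p₁′ _)) ya))

  no-fork : ∀ a x p y q → IsPath G (a ∷ x ∷ p) → IsPath G (a ∷ y ∷ q) →
            lastFrom x p ≡ lastFrom y q → x ≢ y → ⊥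
  no-fork a x p y q P R e x≢y with y ∈? p
  ... | yes y∈p = no-chord P y∈p (Graph.sym G (proj₁ (proj₁ R)))
  no-fork a x p y [] P R e x≢y | no y∉p with lastFrom-∈ x p
  ... | inj₁ e′ = x≢y (trans (sym e′) e)
  ... | inj₂ m  = y∉p (subst (_∈ p) e m)
  no-fork a x p y (z ∷ q) P R@(_ , uR) e x≢y | no y∉p =
    no-fork y a (x ∷ p) z q P′ (IsPath-tail G R) e a≢z
    where
    a≢z : a ≢ z
    a≢z a≡z = Unique[x∷xs]⇒x∉xs uR (there (here a≡z))
    y∉ : y ∉ a ∷ x ∷ p
    y∉ (here y≡a)         = Unique[x∷xs]⇒x∉xs uR (here (sym y≡a))
    y∉ (there (here y≡x)) = x≢y (sym y≡x)
    y∉ (there (there m))  = y∉p m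
    P′ : IsPath G (y ∷ a ∷ x ∷ p)
    P′ = (Graph.sym G (proj₁ (proj₁ R)) , proj₁ P) , Unique-∷ y∉ (proj₂ P)

  IsPath-unique : ∀ a p q → IsPath G (a ∷ p) → IsPath G (a ∷ q) → lastFrom a p ≡ lastFrom a q → p ≡ q
  IsPath-unique a []      []      _ _ _ = refl
  IsPath-unique a []      (y ∷ q) _ (_ , u) e with lastFrom-∈ y q
  ... | inj₁ e′ = ⊥-elim (Unique[x∷xs]⇒x∉xs u (here (trans e e′)))
  ... | inj₂ m  = ⊥-elim (Unique[x∷xs]⇒x∉xs u (there (subst (_∈ q) (sym e) m)))
  IsPath-unique a (x ∷ p) []      (_ , u) _ e with lastFrom-∈ x p
  ... | inj₁ e′ = ⊥-elim (Unique[x∷xs]⇒x∉xs u (here (trans (sym e) e′)))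
  ... | inj₂ m  = ⊥-elim (Unique[x∷xs]⇒x∉xs u (there (subst (_∈ p) e m)))
  IsPath-unique a (x ∷ p) (y ∷ q) P R e with x ≟ y
  ... | yes refl = cong (x ∷_) (IsPath-unique x p q (IsPath-tail G P) (IsPath-tail G R) e)
  ... | no x≢y   = ⊥-elim (no-fork a x p y q P R e x≢y)

module RootedTree {n} (G : Graph n) (acyclic : Acyclic G) (r : Fin n)
  (rootPath : Fin n → List (Fin n))
  (rootPath-IsPath : ∀ x → IsPath G (x ∷ rootPath x))
  (rootPath-ends : ∀ x → lastFrom x (rootPath x) ≡ r) where
  open Tree G acyclic
  open import Data.List.Membership.DecPropositional (_≟_ {n}) using (_∈?_)

  parent : Fin n → Fin n
  parent x = firstOr x (rootPath x)

  depth : Fin n → ℕ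
  depth x = length (rootPath x)

  rootPath-root : rootPath r ≡ []
  rootPath-root = sym (IsPath-unique r [] (rootPath r) (tt , [] ∷ []) (rootPath-IsPath r) (sym (rootPath-ends r)))

  rootPath-parent : ∀ x → x ≢ r → rootPath x ≡ parent x ∷ rootPath (parent x)
  rootPath-parent x x≢r with rootPath x | rootPath-IsPath x | rootPath-ends x
  ... | []    | _ | x≡r = ⊥-elim (x≢r x≡r)
  ... | y ∷ t | P | e   = cong (y ∷_) (IsPath-unique y t (rootPath y) (IsPath-tail G P) (rootPath-IsPath y)
                                         (trans e (sym (rootPath-ends y))))

  depth-parent : ∀ x → x ≢ r → depth x ≡ suc (depth (parent x))
  depth-parent x x≢r = cong length (rootPath-parent x x≢r)

  depth≡0⇒root : ∀ x → depth x ≡ 0 → x ≡ r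
  depth≡0⇒root x e with x ≟ r
  ... | yes x≡r = x≡r
  ... | no x≢r with () ← trans (sym e) (depth-parent x x≢r)

  depth-root : depth r ≡ 0
  depth-root = cong length rootPath-root

  parent-adj : ∀ x → x ≢ r → Adj G x (parent x)
  parent-adj x x≢r = proj₁ (proj₁ (subst (λ t → IsPath G (x ∷ t)) (rootPath-parent x x≢r) (rootPath-IsPath x)))

  parent-parent-≢ : ∀ x → x ≢ r → parent x ≢ r → parent (parent x) ≢ x
  parent-parent-≢ x x≢r px≢r e = ℕP.m≢1+n+m (depth x)
    (trans (trans (depth-parent x x≢r) (cong suc (depth-parent (parent x) px≢r)))
           (cong (λ t → suc (suc (depth t))) e))

  Adj⇒parent : ∀ u v → Adj G u v → (u ≢ r × parent u ≡ v) ⊎ (v ≢ r × parent v ≡ u)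
  Adj⇒parent u v a with v ∈? (u ∷ rootPath u)
  ... | yes (here v≡u) = ⊥-elim (irrefl G (subst (Adj G u) v≡u a))
  ... | yes (there v∈) = inj₁ (on-rootPath (rootPath u) refl v∈)
    where
    on-rootPath : ∀ t → rootPath u ≡ t → v ∈ t → u ≢ r × parent u ≡ v
    on-rootPath (y ∷ t) e (here v≡y)  = u≢r , trans (cong (firstOr u) e) (sym v≡y)
      where
      u≢r : u ≢ r
      u≢r refl with () ← trans (sym e) rootPath-root
    on-rootPath (y ∷ t) e (there v∈t) = ⊥-elim (no-chord (subst (λ t → IsPath G (u ∷ t)) e (rootPath-IsPath u))
                                                   v∈t (Graph.sym G a))
  ... | no v∉ = inj₂ (v≢r , cong (firstOr v) (sym u∷rootPath-u))
    where
    u∷rootPath-u : u ∷ rootPath u ≡ rootPath v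
    u∷rootPath-u = IsPath-unique v (u ∷ rootPath u) (rootPath v)
      ((Graph.sym G a , proj₁ (rootPath-IsPath u)) , Unique-∷ v∉ (proj₂ (rootPath-IsPath u)))
      (rootPath-IsPath v) (trans (rootPath-ends u) (sym (rootPath-ends v)))
    v≢r : v ≢ r
    v≢r refl with () ← trans u∷rootPath-u rootPath-root

module _ where
  open import Algebra.Properties.CommutativeMonoid.Sum ℕP.+-0-commutativeMonoid using (sum; sum-permute)
  open import Data.Fin.Permutation using (permutation)

  indicator : ∀ {P : Set} → Dec P → ℕ
  indicator (yes _) = 1
  indicator (no _)  = 0

  count : ∀ {k} {P : Fin k → Set} → (∀ i → Dec (P i)) → ℕ
  count P? = sum (λ i → indicator (P? i))

  count-permute : ∀ {k} {P : Fin k → Set} (P? : ∀ i → Dec (P i)) (σ : Fin k → Fin k) →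
    (∀ i → σ (σ i) ≡ i) → count (λ i → P? (σ i)) ≡ count P?
  count-permute P? σ σσ = sym (sum-permute (λ i → indicator (P? i)) (permutation σ σ σσ σσ))

count-⊎ : ∀ {k} {P Q R : Fin k → Set} (P? : ∀ i → Dec (P i)) (Q? : ∀ i → Dec (Q i)) (R? : ∀ i → Dec (R i)) →
  (∀ i → P i → Q i ⊎ R i) → (∀ i → Q i → P i) → (∀ i → R i → P i) → (∀ i → Q i → ¬ R i) →
  count P? ≡ count Q? + count R?
count-⊎ {zero} P? Q? R? _ _ _ _ = refl
count-⊎ {suc k} P? Q? R? PQR QP RP Q¬R
  with P? Fin.zero | Q? Fin.zero | R? Fin.zero
     | count-⊎ (λ i → P? (Fin.suc i)) (λ i → Q? (Fin.suc i)) (λ i → R? (Fin.suc i))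
         (λ i → PQR (Fin.suc i)) (λ i → QP (Fin.suc i)) (λ i → RP (Fin.suc i)) (λ i → Q¬R (Fin.suc i))
... | yes _ | yes q | yes r | _  = ⊥-elim (Q¬R Fin.zero q r)
... | yes _ | yes _ | no _  | ih = cong suc ih
... | yes _ | no _  | yes _ | ih = trans (cong suc ih) (sym (ℕP.+-suc _ _))
... | yes p | no ¬q | no ¬r | _  with PQR Fin.zero p
...   | inj₁ q = ⊥-elim (¬q q)
...   | inj₂ r = ⊥-elim (¬r r)
count-⊎ {suc k} P? Q? R? _ QP RP _ | no ¬p | yes q | _     | _  = ⊥-elim (¬p (QP Fin.zero q))
count-⊎ {suc k} P? Q? R? _ QP RP _ | no ¬p | no _  | yes r | _  = ⊥-elim (¬p (RP Fin.zero r))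
count-⊎ {suc k} P? Q? R? _ QP RP _ | no _  | no _  | no _  | ih = ih

count-cong : ∀ {k} {P Q : Fin k → Set} (P? : ∀ i → Dec (P i)) (Q? : ∀ i → Dec (Q i)) →
  (∀ i → P i → Q i) → (∀ i → Q i → P i) → count P? ≡ count Q?
count-cong {zero} P? Q? _ _ = refl
count-cong {suc k} P? Q? PQ QP with P? Fin.zero | Q? Fin.zero
  | count-cong (λ i → P? (Fin.suc i)) (λ i → Q? (Fin.suc i)) (λ i → PQ (Fin.suc i)) (λ i → QP (Fin.suc i))
... | yes _ | yes _ | ih = cong suc ih
... | yes p | no ¬q | _  = ⊥-elim (¬q (PQ Fin.zero p))
... | no ¬p | yes q | _  = ⊥-elim (¬p (QP Fin.zero q))
... | no _  | no _  | ih = ih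

count-≡0 : ∀ {k} {P : Fin k → Set} (P? : ∀ i → Dec (P i)) → (∀ i → ¬ P i) → count P? ≡ 0
count-≡0 {zero} P? _ = refl
count-≡0 {suc k} P? ¬P with P? Fin.zero
... | yes p = ⊥-elim (¬P Fin.zero p)
... | no _  = count-≡0 (λ i → P? (Fin.suc i)) (λ i → ¬P (Fin.suc i))

count-≥1 : ∀ {k} {P : Fin k → Set} (P? : ∀ i → Dec (P i)) z → P z → 1 ≤ count P?
count-≥1 P? Fin.zero pz with P? Fin.zero
... | yes _ = s≤s z≤n
... | no ¬p = ⊥-elim (¬p pz)
count-≥1 P? (Fin.suc z) pz =
  ℕP.≤-trans (count-≥1 (λ i → P? (Fin.suc i)) z pz) (ℕP.m≤n+m _ (indicator (P? Fin.zero)))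

count-≡1 : ∀ {k} {P : Fin k → Set} (P? : ∀ i → Dec (P i)) z → P z → (∀ i → P i → i ≡ z) → count P? ≡ 1
count-≡1 P? Fin.zero pz only with P? Fin.zero
... | yes _ = cong suc (count-≡0 _ λ i p → FinP.0≢1+n (sym (only (Fin.suc i) p)))
... | no ¬p = ⊥-elim (¬p pz)
count-≡1 P? (Fin.suc z) pz only with P? Fin.zero
... | yes p with () ← only Fin.zero p
... | no _  = count-≡1 (λ i → P? (Fin.suc i)) z pz (λ i p → FinP.suc-injective (only (Fin.suc i) p))

count-< : ∀ {k} {P Q : Fin k → Set} (P? : ∀ i → Dec (P i)) (Q? : ∀ i → Dec (Q i)) →
  (∀ i → P i → Q i) → ∀ z → Q z → ¬ P z → count P? < count Q?
count-< {P = P} {Q} P? Q? PQ z qz ¬pz = subst (count P? <_) (sym split)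
    (subst (_≤ count P? + count Q∖P?) (ℕP.+-comm (count P?) 1)
       (ℕP.+-monoʳ-≤ (count P?) (count-≥1 Q∖P? z (qz , ¬pz))))
  where
  Q∖P? : ∀ i → Dec (Q i × ¬ P i)
  Q∖P? = λ i → Q? i ×-dec ¬? (P? i)
  split : count Q? ≡ count P? + count Q∖P?
  split = count-⊎ Q? P? Q∖P? P-or-not PQ (λ i → proj₁) (λ i p q¬p → proj₂ q¬p p)
    where
    P-or-not : ∀ i → Q i → P i ⊎ (Q i × ¬ P i)
    P-or-not i q with P? i
    ... | yes p = inj₁ p
    ... | no ¬p = inj₂ (q , ¬p)

count-complement : ∀ {k} {P : Fin k → Set} (P? : ∀ i → Dec (P i)) → count P? + count (λ i → ¬? (P? i)) ≡ k
count-complement {zero} P? = refl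
count-complement {suc k} P? with P? Fin.zero
... | yes _ = cong suc (count-complement (λ i → P? (Fin.suc i)))
... | no _  = trans (ℕP.+-suc _ _) (cong suc (count-complement (λ i → P? (Fin.suc i))))

lex-< : ∀ {n} a b i j → a < b → i < n → a * n + i < b * n + j
lex-< {n} a b i j a<b i<n = ℕP.≤-trans (ℕP.+-monoʳ-< (a * n) i<n)
  (ℕP.≤-trans (subst (_≤ b * n) (ℕP.+-comm n (a * n)) (ℕP.*-monoˡ-≤ n a<b)) (ℕP.m≤m+n (b * n) j))

lex-<⇒≤ : ∀ {n} a b i j → a * n + i < b * n + j → j < n → a ≤ b
lex-<⇒≤ a b i j lt j<n with ℕP.<-cmp a b
... | tri< a<b _ _ = ℕP.<⇒≤ a<b
... | tri≈ _ a≡b _ = ℕP.≤-reflexive a≡b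
... | tri> _ _ b<a = ⊥-elim (ℕP.<-asym lt (lex-< b a j i b<a j<n))

lex-injective : ∀ {n} a b i j → a * n + i ≡ b * n + j → i < n → j < n → i ≡ j
lex-injective a b i j e i<n j<n with ℕP.<-cmp a b
... | tri< a<b _ _  = ⊥-elim (ℕP.<⇒≢ (lex-< a b i j a<b i<n) e)
... | tri> _ _ b<a  = ⊥-elim (ℕP.<⇒≢ (lex-< b a j i b<a j<n) (sym e))
... | tri≈ _ refl _ = ℕP.+-cancelˡ-≡ (a * _) i j e

2*-≤-odd : ∀ a b → 2 * a ≤ suc (2 * b) → a ≤ b
2*-≤-odd a b le with ℕP.≤-<-connex a b
... | inj₁ a≤b = a≤b
... | inj₂ b<a = ⊥-elim (ℕP.<-irrefl refl
      (ℕP.≤-trans (s≤s le) (subst (_≤ 2 * a) (ℕP.*-suc 2 b) (ℕP.*-monoʳ-≤ 2 b<a))))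

∣m∸n-n∣≡∣m-2n∣ : ∀ m n → n ≤ m → ∣ (m ∸ n) - n ∣ ≡ ∣ m - 2 * n ∣
∣m∸n-n∣≡∣m-2n∣ m n n≤m = begin
  ∣ (m ∸ n) - n ∣         ≡⟨ sym (ℕP.∣m+n-m+o∣≡∣n-o∣ n (m ∸ n) n) ⟩
  ∣ n + (m ∸ n) - n + n ∣ ≡⟨ cong₂ ∣_-_∣ (ℕP.m+[n∸m]≡n n≤m) (cong (n +_) (sym (ℕP.+-identityʳ n))) ⟩
  ∣ m - 2 * n ∣           ∎
  where open ≡-Reasoning

m∸a≡b∸m⇒a+b≡2m : ∀ {m} a b → a ≤ m → m ≤ b → m ∸ a ≡ b ∸ m → a + b ≡ 2 * m
m∸a≡b∸m⇒a+b≡2m {m} a b a≤m m≤b e = begin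
  a + b           ≡⟨ cong (a +_) (sym (ℕP.m∸n+n≡m m≤b)) ⟩
  a + (b ∸ m + m) ≡⟨ cong (λ z → a + (z + m)) (sym e) ⟩
  a + (m ∸ a + m) ≡⟨ sym (ℕP.+-assoc a (m ∸ a) m) ⟩
  a + (m ∸ a) + m ≡⟨ cong (_+ m) (ℕP.m+[n∸m]≡n a≤m) ⟩
  m + m           ≡⟨ cong (m +_) (sym (ℕP.+-identityʳ m)) ⟩
  2 * m           ∎
  where open ≡-Reasoning

∣m-a∣≡∣m-b∣ : ∀ m a b → ∣ m - a ∣ ≡ ∣ m - b ∣ → a ≡ b ⊎ a + b ≡ 2 * m
∣m-a∣≡∣m-b∣ m a b e with ℕP.≤-total a m | ℕP.≤-total b m
... | inj₁ a≤m | inj₁ b≤m = inj₁ (ℕP.∸-cancelˡ-≡ a≤m b≤m (trans (sym (ℕP.m≤n⇒∣n-m∣≡n∸m a≤m)) (trans e (ℕP.m≤n⇒∣n-m∣≡n∸m b≤m))))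
... | inj₂ m≤a | inj₂ m≤b = inj₁ (ℕP.∸-cancelʳ-≡ m≤a m≤b
                              (trans (sym (ℕP.m≤n⇒∣m-n∣≡n∸m m≤a)) (trans e (ℕP.m≤n⇒∣m-n∣≡n∸m m≤b))))
... | inj₁ a≤m | inj₂ m≤b = inj₂ (m∸a≡b∸m⇒a+b≡2m a b a≤m m≤b
                              (trans (sym (ℕP.m≤n⇒∣n-m∣≡n∸m a≤m)) (trans e (ℕP.m≤n⇒∣m-n∣≡n∸m m≤b))))
... | inj₂ m≤a | inj₁ b≤m = inj₂ (trans (ℕP.+-comm a b) (m∸a≡b∸m⇒a+b≡2m b a b≤m m≤a
                              (trans (sym (ℕP.m≤n⇒∣n-m∣≡n∸m b≤m)) (trans (sym e) (ℕP.m≤n⇒∣m-n∣≡n∸m m≤a)))))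

∣m∸1∸b-a∣≡m∸[1+a+b] : ∀ m a b → a + b < m → ∣ (m ∸ 1 ∸ b) - a ∣ ≡ m ∸ suc (a + b)
∣m∸1∸b-a∣≡m∸[1+a+b] m a b a+b<m = begin
  ∣ (m ∸ 1 ∸ b) - a ∣ ≡⟨ ℕP.m≤n⇒∣n-m∣≡n∸m a≤ ⟩
  m ∸ 1 ∸ b ∸ a       ≡⟨ ℕP.∸-+-assoc (m ∸ 1) b a ⟩
  m ∸ 1 ∸ (b + a)     ≡⟨ ℕP.∸-+-assoc m 1 (b + a) ⟩
  m ∸ suc (b + a)     ≡⟨ cong (λ z → m ∸ suc z) (ℕP.+-comm b a) ⟩
  m ∸ suc (a + b)     ∎
  where
  open ≡-Reasoning
  a≤ : a ≤ m ∸ 1 ∸ b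
  a≤ = subst (a ≤_) (sym (ℕP.∸-+-assoc m 1 b)) (ℕP.m+n≤o⇒m≤o∸n a (subst (_≤ m) (sym (ℕP.+-suc a b)) a+b<m))

<∧<⇒≢m∸1∸ : ∀ {a b s t m} → a < s → b < t → s + t ≡ m → a ≢ m ∸ 1 ∸ b
<∧<⇒≢m∸1∸ {a} {b} {s} {t} {m} a<s b<t s+t≡m a≡m∸1∸b = ℕP.<-irrefl a+1+b≡m (ℕP.≤-trans (ℕP.+-mono-≤ a<s b<t) (ℕP.≤-reflexive s+t≡m))
  where
  a+1+b≡m : a + suc b ≡ m
  a+1+b≡m = trans (cong (_+ suc b) (trans a≡m∸1∸b (ℕP.∸-+-assoc m 1 b)))
              (ℕP.m∸n+n≡m (ℕP.≤-trans b<t (ℕP.≤-trans (ℕP.m≤n+m t s) (ℕP.≤-reflexive s+t≡m))))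

∣∣m-n∣∧∣n⇒∣m : ∀ {d} m n → d ∣ ∣ m - n ∣ → d ∣ n → d ∣ m
∣∣m-n∣∧∣n⇒∣m {d} m n d∣m-n d∣n with ℕP.≤-total n m
... | inj₁ n≤m = ∣m∸n∣n⇒∣m d n≤m (subst (d ∣_) (ℕP.m≤n⇒∣n-m∣≡n∸m n≤m) d∣m-n) d∣n
... | inj₂ m≤n = ∣m+n∣m⇒∣n (subst (d ∣_) (sym (ℕP.m∸n+n≡m m≤n)) d∣n)
                   (subst (d ∣_) (ℕP.m≤n⇒∣m-n∣≡n∸m m≤n) d∣m-n)

2∤1+2k : ∀ k → ¬ 2 ∣ suc (2 * k)
2∤1+2k k 2∣1+2k with ∣1⇒≡1 (∣m+n∣m⇒∣n (subst (2 ∣_) (ℕP.+-comm 1 (2 * k)) 2∣1+2k) (m∣m*n k))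
... | ()

injective⇒surjective : ∀ {n} (f : Fin n → Fin n) → Injective _≡_ _≡_ f → Surjective _≡_ _≡_ f
injective⇒surjective {suc k} f f-inj y with FinP.any? (λ x → f x ≟ y)
... | yes (x , fx≡y) = x , λ { refl → fx≡y }
... | no ∄x = ⊥-elim (ℕP.<-irrefl refl (FinP.injective⇒≤ {f = g} g-inj))
  where
  -- f misses y, so it factors injectively through Fin k
  g : Fin (suc k) → Fin k
  g i = punchOut {i = y} {j = f i} (λ e → ∄x (i , sym e))
  g-inj : Injective _≡_ _≡_ g
  g-inj {i} {j} e = f-inj (FinP.punchOut-injective {i = y} (λ e → ∄x (i , sym e)) (λ e → ∄x (j , sym e)) e)

-- Contracting the matching edges

module Contraction {n} (G : Graph n) (acyclic : Acyclic G) (r : Fin n)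
  (rootPath : Fin n → List (Fin n))
  (rootPath-IsPath : ∀ x → IsPath G (x ∷ rootPath x))
  (rootPath-ends : ∀ x → lastFrom x (rootPath x) ≡ r)
  (π : Fin n → Fin n) (π-involutive : ∀ x → π (π x) ≡ x) (π-adj : ∀ x → Adj G x (π x))
  (π-leaf : ∀ x → Leaf G x ⊎ Leaf G (π x))
  (w₁ w₂ : Fin n) (r-w₁ : Adj G r w₁) (r-w₂ : Adj G r w₂) (w₁≢w₂ : w₁ ≢ w₂) where

  open RootedTree G acyclic r rootPath rootPath-IsPath rootPath-ends

  -- the endpoint of its matching edge that is closer to the root
  Upper : Fin n → Set
  Upper x = x ≡ r ⊎ parent x ≢ π x

  Upper? : ∀ x → Dec (Upper x)
  Upper? x = (x ≟ r) ⊎-dec ¬? (parent x ≟ π x)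

  Upper-root : Upper r
  Upper-root = inj₁ refl

  ¬Upper⇒ : ∀ {x} → ¬ Upper x → x ≢ r × parent x ≡ π x
  ¬Upper⇒ {x} ¬up with parent x ≟ π x
  ... | yes e  = (λ x≡r → ¬up (inj₁ x≡r)) , e
  ... | no ¬e  = ⊥-elim (¬up (inj₂ ¬e))

  Upper⇒parent≢π : ∀ {x} → Upper x → x ≢ r → parent x ≢ π x
  Upper⇒parent≢π (inj₁ x≡r) x≢r = ⊥-elim (x≢r x≡r)
  Upper⇒parent≢π (inj₂ p≢π) _   = p≢π

  Upper⇒¬Upper-π : ∀ x → Upper x → ¬ Upper (π x)
  Upper⇒¬Upper-π x up up-π with Adj⇒parent x (π x) (π-adj x)
  Upper⇒¬Upper-π x (inj₁ x≡r) _ | inj₁ (x≢r , _) = x≢r x≡r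
  Upper⇒¬Upper-π x (inj₂ p≢π) _ | inj₁ (_ , p≡π) = p≢π p≡π
  Upper⇒¬Upper-π x _ (inj₁ πx≡r) | inj₂ (πx≢r , _)  = πx≢r πx≡r
  Upper⇒¬Upper-π x _ (inj₂ p≢ππ) | inj₂ (_ , p≡x)   = p≢ππ (trans p≡x (sym (π-involutive x)))

  ¬Upper⇒Upper-π : ∀ x → ¬ Upper x → Upper (π x)
  ¬Upper⇒Upper-π x ¬up with Upper? (π x) | ¬Upper⇒ ¬up
  ... | yes up-π   | _ = up-π
  ... | no ¬up-π   | x≢r , p≡π with ¬Upper⇒ ¬up-π
  ...   | πx≢r , pπ≡ππ = ⊥-elim (parent-parent-≢ x x≢r (subst (_≢ r) (sym p≡π) πx≢r)
                           (trans (cong parent p≡π) (trans pπ≡ππ (π-involutive x))))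

  -- A lower vertex p = parent c has the neighbours c and parent p, so it is not
  -- a leaf, and neither is its partner parent p (r has w₁ and w₂, any other
  -- vertex its own parent and p).
  Upper-parent : ∀ c → Upper c → c ≢ r → Upper (parent c)
  Upper-parent c up c≢r with Upper? (parent c)
  ... | yes up-p = up-p
  ... | no ¬up-p with ¬Upper⇒ ¬up-p | π-leaf (parent c)
  ...   | p≢r , pp≡πp | inj₁ p-leaf = ⊥-elim $ Upper⇒parent≢π up c≢r $
            trans (sym (π-involutive (parent c))) (cong π (sym (trans c≡pp pp≡πp)))
    where
    c≡pp : c ≡ parent (parent c)
    c≡pp = Leaf⇒≡ G p-leaf (Graph.sym G (parent-adj c c≢r)) (parent-adj (parent c) p≢r)
  ...   | p≢r , pp≡πp | inj₂ πp-leaf with parent (parent c) ≟ r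
  ...     | yes pp≡r = ⊥-elim $ w₁≢w₂ $
            Leaf⇒≡ G (subst (Leaf G) (trans (sym pp≡πp) pp≡r) πp-leaf) r-w₁ r-w₂
  ...     | no pp≢r = ⊥-elim $ parent-parent-≢ (parent c) p≢r pp≢r $ sym $
            Leaf⇒≡ G (subst (Leaf G) (sym pp≡πp) πp-leaf)
              (Graph.sym G (parent-adj (parent c) p≢r)) (parent-adj (parent (parent c)) pp≢r)

  Upper-parent-of-lower : ∀ c → ¬ Upper c → Upper (parent c)
  Upper-parent-of-lower c ¬up = subst Upper (sym (proj₂ (¬Upper⇒ ¬up))) (¬Upper⇒Upper-π c ¬up)

  module Caterpillar (spine : List (Fin n)) (r∈spine : r ∈ spine)
    (spine-parent : ∀ x → x ∈ spine → x ≢ r → parent x ∈ spine)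
    (spine-depth-injective : ∀ x y → x ∈ spine → y ∈ spine → depth x ≡ depth y → x ≡ y)
    (near-spine : ∀ x → x ≢ r → parent x ∈ spine ⊎ parent (parent x) ∈ spine) where
    open import Data.List.Membership.DecPropositional (_≟_ {n}) using (_∈?_)

    -- A leg y of the caterpillar hangs from the spine: otherwise its lower
    -- partner π y, a child of y, would be three steps away from the spine.
    leg-parent : ∀ y → y ∉ spine → parent y ≢ π y → parent y ∈ spine
    leg-parent y y∉ p≢π with Adj⇒parent y (π y) (π-adj y)
    ... | inj₁ (_ , p≡π) = ⊥-elim (p≢π p≡π)
    ... | inj₂ (πy≢r , pπ≡y) with near-spine (π y) πy≢r
    ...   | inj₁ pπ∈  = ⊥-elim (y∉ (subst (_∈ spine) pπ≡y pπ∈))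
    ...   | inj₂ ppπ∈ = subst (λ z → parent z ∈ spine) pπ≡y ppπ∈

    -- Vertices are ordered by key, then by index: a spine vertex of depth d
    -- has key 2d and the legs hanging from it (depth d + 1) have key 2d + 1.
    key′ : ∀ {x} → Dec (x ∈ spine) → ℕ → ℕ
    key′ (yes _) d = 2 * d
    key′ (no _)  d = 2 * d ∸ 1

    key : Fin n → ℕ
    key x = key′ (x ∈? spine) (depth x)

    pos : Fin n → ℕ
    pos x = key x * n + toℕ x

    key-spine : ∀ {x} → x ∈ spine → key x ≡ 2 * depth x
    key-spine {x} x∈ with x ∈? spine
    ... | yes _ = refl
    ... | no x∉ = ⊥-elim (x∉ x∈)

    key-leg : ∀ {x} → x ∉ spine → key x ≡ suc (2 * depth (parent x))
    key-leg {x} x∉ with x ∈? spine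
    ... | yes x∈ = ⊥-elim (x∉ x∈)
    ... | no _   = odd-key (depth-parent x λ { refl → x∉ r∈spine })
      where
      odd-key : ∀ {d e} → d ≡ suc e → 2 * d ∸ 1 ≡ suc (2 * e)
      odd-key {e = e} refl = cong (_∸ 1) (ℕP.*-suc 2 e)

    pos-injective : ∀ {x y} → pos x ≡ pos y → x ≡ y
    pos-injective {x} {y} e = FinP.toℕ-injective
      (lex-injective (key x) (key y) (toℕ x) (toℕ y) e (FinP.toℕ<n x) (FinP.toℕ<n y))

    parent∈spine : ∀ c → Upper c → c ≢ r → parent c ∈ spine
    parent∈spine c up c≢r with c ∈? spine
    ... | yes c∈ = spine-parent c c∈ c≢r
    ... | no c∉  = leg-parent c c∉ (Upper⇒parent≢π up c≢r)

    key-parent : ∀ c → Upper c → c ≢ r →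
      key c ≡ suc (key (parent c)) ⊎ key c ≡ suc (suc (key (parent c)))
    key-parent c up c≢r = by-membership (c ∈? spine)
      where
      key-p : key (parent c) ≡ 2 * depth (parent c)
      key-p = key-spine (parent∈spine c up c≢r)
      by-membership : Dec (c ∈ spine) → key c ≡ suc (key (parent c)) ⊎ key c ≡ suc (suc (key (parent c)))
      by-membership (yes c∈) = inj₂ (trans (key-spine c∈) (trans (cong (2 *_) (depth-parent c c≢r))
                                 (trans (ℕP.*-suc 2 (depth (parent c))) (cong (suc ∘′ suc) (sym key-p)))))
      by-membership (no c∉)  = inj₁ (trans (key-leg c∉) (cong suc (sym key-p)))

    pos-parent : ∀ c → Upper c → c ≢ r → pos (parent c) < pos c
    pos-parent c up c≢r = lex-< (key (parent c)) (key c) (toℕ (parent c)) (toℕ c) key< (FinP.toℕ<n (parent c))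
      where
      key< : key (parent c) < key c
      key< with key-parent c up c≢r
      ... | inj₁ e = ℕP.≤-reflexive (sym e)
      ... | inj₂ e = ℕP.≤-trans (ℕP.n≤1+n _) (ℕP.≤-reflexive (sym e))

    key≤2+key-parent : ∀ c → Upper c → c ≢ r → key c ≤ suc (suc (key (parent c)))
    key≤2+key-parent c up c≢r with key-parent c up c≢r
    ... | inj₁ e = ℕP.≤-trans (ℕP.≤-reflexive e) (ℕP.n≤1+n _)
    ... | inj₂ e = ℕP.≤-reflexive e

    pos-between : ∀ c y → Upper c → c ≢ r → pos (parent c) < pos y → pos y < pos c → depth y ≡ depth c
    pos-between c y up c≢r p<y y<c = by-membership (y ∈? spine)
      where
      p : Fin n
      p = parent c
      key-p : key p ≡ 2 * depth p
      key-p = key-spine (parent∈spine c up c≢r)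
      p≤y : key p ≤ key y
      p≤y = lex-<⇒≤ (key p) (key y) (toℕ p) (toℕ y) p<y (FinP.toℕ<n y)
      y≤c : key y ≤ key c
      y≤c = lex-<⇒≤ (key y) (key c) (toℕ y) (toℕ c) y<c (FinP.toℕ<n c)
      c≤ : key c ≤ suc (suc (2 * depth p))
      c≤ = subst (λ k → key c ≤ suc (suc k)) key-p (key≤2+key-parent c up c≢r)
      by-membership : Dec (y ∈ spine) → depth y ≡ depth c
      by-membership (yes y∈) with ℕP.m≤n⇒m<n∨m≡n y≤1+p
        where
        y≤1+p : depth y ≤ suc (depth p)
        y≤1+p = ℕP.*-cancelˡ-≤ 2 (subst (2 * depth y ≤_) (sym (ℕP.*-suc 2 (depth p)))
                  (ℕP.≤-trans (subst (_≤ key c) (key-spine y∈) y≤c) c≤))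
      ... | inj₂ y≡1+p = trans y≡1+p (sym (depth-parent c c≢r))
      ... | inj₁ y<1+p = ⊥-elim (ℕP.<-irrefl (cong pos p≡y) p<y)
        where
        p≤y′ : depth p ≤ depth y
        p≤y′ = ℕP.*-cancelˡ-≤ 2 (subst₂ _≤_ key-p (key-spine y∈) p≤y)
        p≡y : p ≡ y
        p≡y = spine-depth-injective p y (parent∈spine c up c≢r) y∈ (ℕP.≤-antisym p≤y′ (ℕP.≤-pred y<1+p))
      by-membership (no y∉) = trans (depth-parent y λ { refl → y∉ r∈spine })
                                (trans (cong suc (ℕP.≤-antisym e≤p p≤e)) (sym (depth-parent c c≢r)))
        where
        e : ℕ
        e = depth (parent y)
        p≤e : depth p ≤ e
        p≤e = 2*-≤-odd (depth p) e (subst₂ _≤_ key-p (key-leg y∉) p≤y)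
        e≤p : e ≤ depth p
        e≤p = 2*-≤-odd e (depth p) (ℕP.≤-pred (subst (_≤ suc (suc (2 * depth p))) (key-leg y∉) (ℕP.≤-trans y≤c c≤)))

    root-first : ∀ y → ¬ pos y < pos r
    root-first y y<r = by-membership (y ∈? spine)
      where
      key-r : key r ≡ 0
      key-r = trans (key-spine r∈spine) (cong (2 *_) depth-root)
      key-y : key y ≡ 0
      key-y = ℕP.n≤0⇒n≡0 (subst (key y ≤_) key-r (lex-<⇒≤ (key y) (key r) (toℕ y) (toℕ r) y<r (FinP.toℕ<n r)))
      by-membership : Dec (y ∈ spine) → ⊥
      by-membership (yes y∈) = ℕP.<-irrefl (cong pos (depth≡0⇒root y depth-y)) y<r
        where
        depth-y : depth y ≡ 0
        depth-y = ℕP.n≤0⇒n≡0 (ℕP.≤-trans (ℕP.m≤n*m (depth y) 2) (ℕP.≤-reflexive (trans (sym (key-spine y∈)) key-y)))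
      by-membership (no y∉) with () ← trans (sym key-y) (key-leg y∉)

    evenᵇ : ℕ → Bool
    evenᵇ zero    = true
    evenᵇ (suc d) = not (evenᵇ d)

    colour : Fin n → Bool
    colour x = evenᵇ (depth x)

    colour-parent : ∀ c → c ≢ r → colour c ≡ not (colour (parent c))
    colour-parent c c≢r = cong evenᵇ (depth-parent c c≢r)

    Earlier : Fin n → Fin n → Set
    Earlier x y = Upper y × pos y < pos x

    Earlier? : ∀ x y → Dec (Earlier x y)
    Earlier? x y = Upper? y ×-dec pos y ℕP.<? pos x

    EarlierOfColour : Bool → Fin n → Fin n → Set
    EarlierOfColour b x y = Upper y × colour y ≡ b × pos y < pos x

    EarlierOfColour? : ∀ b x y → Dec (EarlierOfColour b x y)
    EarlierOfColour? b x y = Upper? y ×-dec colour y BoolP.≟ b ×-dec pos y ℕP.<? pos x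

    OfColour : Bool → Fin n → Set
    OfColour b y = Upper y × colour y ≡ b

    OfColour? : ∀ b y → Dec (OfColour b y)
    OfColour? b y = Upper? y ×-dec colour y BoolP.≟ b

    m : ℕ
    m = count Upper?

    rank : Fin n → ℕ
    rank x = count (Earlier? x)

    earlier : Bool → Fin n → ℕ
    earlier b x = count (EarlierOfColour? b x)

    total : Bool → ℕ
    total b = count (OfColour? b)

    label′ : Bool → Fin n → ℕ
    label′ true  x = earlier true x
    label′ false x = m ∸ 1 ∸ earlier false x

    label : Fin n → ℕ
    label x = label′ (colour x) x

    true-or-false : ∀ (b : Bool) → b ≡ true ⊎ b ≡ false
    true-or-false true  = inj₁ refl
    true-or-false false = inj₂ refl

    rank≡earlier+earlier : ∀ x → rank x ≡ earlier true x + earlier false x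
    rank≡earlier+earlier x = count-⊎ (Earlier? x) (EarlierOfColour? true x) (EarlierOfColour? false x)
      (λ y (up , y<x) → Sum.map (λ e → up , e , y<x) (λ e → up , e , y<x) (true-or-false (colour y)))
      (λ y (up , _ , y<x) → up , y<x) (λ y (up , _ , y<x) → up , y<x)
      (λ y (_ , e₁ , _) (_ , e₂ , _) → BoolP.not-¬ refl (trans (sym e₁) e₂))

    m≡total+total : m ≡ total true + total false
    m≡total+total = count-⊎ Upper? (OfColour? true) (OfColour? false)
      (λ y up → Sum.map (up ,_) (up ,_) (true-or-false (colour y)))
      (λ y → proj₁) (λ y → proj₁)
      (λ y (_ , e₁) (_ , e₂) → BoolP.not-¬ refl (trans (sym e₁) e₂))

    earlier<total : ∀ x b → Upper x → colour x ≡ b → earlier b x < total b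
    earlier<total x b up cx = count-< (EarlierOfColour? b x) (OfColour? b)
      (λ y (up , cy , _) → up , cy) x (up , cx) (λ (_ , _ , x<x) → ℕP.<-irrefl refl x<x)

    earlier<m : ∀ x b → Upper x → colour x ≡ b → earlier b x < m
    earlier<m x b up cx = ℕP.≤-trans (earlier<total x b up cx) (total≤m b)
      where
      total≤m : ∀ b → total b ≤ m
      total≤m true  = ℕP.≤-trans (ℕP.m≤m+n _ _) (ℕP.≤-reflexive (sym m≡total+total))
      total≤m false = ℕP.≤-trans (ℕP.m≤n+m _ _) (ℕP.≤-reflexive (sym m≡total+total))

    rank<m : ∀ x → Upper x → rank x < m
    rank<m x up = count-< (Earlier? x) Upper? (λ y → proj₁) x up (λ (_ , x<x) → ℕP.<-irrefl refl x<x)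

    earlier-mono : ∀ x y b → Upper x → colour x ≡ b → pos x < pos y → earlier b x < earlier b y
    earlier-mono x y b up cx x<y = count-< (EarlierOfColour? b x) (EarlierOfColour? b y)
      (λ z (up , cz , z<x) → up , cz , ℕP.<-trans z<x x<y) x (up , cx , x<y) (λ (_ , _ , x<x) → ℕP.<-irrefl refl x<x)

    rank-mono : ∀ x y → Upper x → pos x < pos y → rank x < rank y
    rank-mono x y up x<y = count-< (Earlier? x) (Earlier? y)
      (λ z (up , z<x) → up , ℕP.<-trans z<x x<y) x (up , x<y) (λ (_ , x<x) → ℕP.<-irrefl refl x<x)

    rank-injective : ∀ x y → Upper x → Upper y → rank x ≡ rank y → x ≡ y
    rank-injective x y up-x up-y e with ℕP.<-cmp (pos x) (pos y)
    ... | tri< x<y _ _ = ⊥-elim (ℕP.<⇒≢ (rank-mono x y up-x x<y) e)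
    ... | tri≈ _ x≡y _ = pos-injective x≡y
    ... | tri> _ _ y<x = ⊥-elim (ℕP.<⇒≢ (rank-mono y x up-y y<x) (sym e))

    -- Between parent c and c there are only vertices of the colour of c.
    earlier-parent : ∀ c → Upper c → c ≢ r →
      earlier (colour (parent c)) c ≡ suc (earlier (colour (parent c)) (parent c))
    earlier-parent c up c≢r =
      trans (count-⊎ (EarlierOfColour? b c) (λ y → y ≟ p) (EarlierOfColour? b p) split
               (λ { y refl → Upper-parent c up c≢r , refl , pos-parent c up c≢r })
               (λ y (up-y , cy , y<p) → up-y , cy , ℕP.<-trans y<p (pos-parent c up c≢r))
               (λ { y refl (_ , _ , p<p) → ℕP.<-irrefl refl p<p }))
            (cong (_+ earlier b p) (count-≡1 (λ y → y ≟ p) p refl (λ y e → e)))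
      where
      p : Fin n
      p = parent c
      b : Bool
      b = colour p
      split : ∀ y → EarlierOfColour b c y → y ≡ p ⊎ EarlierOfColour b p y
      split y (up-y , cy , y<c) with ℕP.<-cmp (pos y) (pos p)
      ... | tri< y<p _ _ = inj₂ (up-y , cy , y<p)
      ... | tri≈ _ e _   = inj₁ (pos-injective e)
      ... | tri> _ _ p<y = ⊥-elim (BoolP.not-¬ refl
              (trans (sym cy) (trans (cong evenᵇ (pos-between c y up c≢r p<y y<c)) (colour-parent c c≢r))))

    label-true : ∀ x → colour x ≡ true → label x ≡ earlier true x
    label-true x e = cong (λ b → label′ b x) e

    label-false : ∀ x → colour x ≡ false → label x ≡ m ∸ 1 ∸ earlier false x
    label-false x e = cong (λ b → label′ b x) e

    1≤m : 1 ≤ m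
    1≤m = count-≥1 Upper? r Upper-root

    ∣m∸1∸b-a∣≡m∸rank : ∀ c a b → Upper c → rank c ≡ suc (a + b) → ∣ (m ∸ 1 ∸ b) - a ∣ ≡ m ∸ rank c
    ∣m∸1∸b-a∣≡m∸rank c a b up e =
      trans (∣m∸1∸b-a∣≡m∸[1+a+b] m a b (ℕP.<⇒≤ (subst (_< m) e (rank<m c up)))) (cong (m ∸_) (sym e))

    label-edge : ∀ c → Upper c → c ≢ r → ∣ label c - label (parent c) ∣ ≡ m ∸ rank c
    label-edge c up c≢r with true-or-false (colour (parent c))
    ... | inj₁ cp = begin
          ∣ label c - label p ∣                          ≡⟨ cong₂ ∣_-_∣ (label-false c cc) (label-true p cp) ⟩
          ∣ (m ∸ 1 ∸ earlier false c) - earlier true p ∣ ≡⟨ ∣m∸1∸b-a∣≡m∸rank c _ (earlier false c) up rank≡ ⟩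
          m ∸ rank c                                     ∎
      where
      open ≡-Reasoning
      p : Fin n
      p = parent c
      cc : colour c ≡ false
      cc = trans (colour-parent c c≢r) (cong not cp)
      rank≡ : rank c ≡ suc (earlier true p + earlier false c)
      rank≡ = trans (rank≡earlier+earlier c) (cong (_+ earlier false c)
                (subst (λ b → earlier b c ≡ suc (earlier b p)) cp (earlier-parent c up c≢r)))
    ... | inj₂ cp = begin
          ∣ label c - label p ∣                          ≡⟨ cong₂ ∣_-_∣ (label-true c cc) (label-false p cp) ⟩
          ∣ earlier true c - (m ∸ 1 ∸ earlier false p) ∣ ≡⟨ ℕP.∣-∣-comm (earlier true c) _ ⟩
          ∣ (m ∸ 1 ∸ earlier false p) - earlier true c ∣ ≡⟨ ∣m∸1∸b-a∣≡m∸rank c _ (earlier false p) up rank≡ ⟩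
          m ∸ rank c                                     ∎
      where
      open ≡-Reasoning
      p : Fin n
      p = parent c
      cc : colour c ≡ true
      cc = trans (colour-parent c c≢r) (cong not cp)
      rank≡ : rank c ≡ suc (earlier true c + earlier false p)
      rank≡ = trans (rank≡earlier+earlier c) (trans (cong (earlier true c +_)
                (subst (λ b → earlier b c ≡ suc (earlier b p)) cp (earlier-parent c up c≢r))) (ℕP.+-suc _ _))

    label<m : ∀ x → Upper x → label x < m
    label<m x up with true-or-false (colour x)
    ... | inj₁ cx = subst (_< m) (sym (label-true x cx)) (earlier<m x true up cx)
    ... | inj₂ cx = subst (_< m) (sym (label-false x cx))
                      (ℕP.≤-<-trans (ℕP.m∸n≤m (m ∸ 1) (earlier false x)) (ℕP.∸-monoʳ-< {o = 0} (s≤s z≤n) 1≤m))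

    label-≢ : ∀ x y → Upper x → Upper y → pos x < pos y → label x ≢ label y
    label-≢ x y up-x up-y x<y with true-or-false (colour x) | true-or-false (colour y)
    ... | inj₁ cx | inj₁ cy = λ e → ℕP.<⇒≢ (earlier-mono x y true up-x cx x<y)
                                      (trans (sym (label-true x cx)) (trans e (label-true y cy)))
    ... | inj₂ cx | inj₂ cy = λ e → ℕP.<⇒≢ (earlier-mono x y false up-x cx x<y)
           (ℕP.∸-cancelˡ-≡ (ℕP.<⇒≤pred (earlier<m x false up-x cx)) (ℕP.<⇒≤pred (earlier<m y false up-y cy))
              (trans (sym (label-false x cx)) (trans e (label-false y cy))))
    ... | inj₁ cx | inj₂ cy = λ e → <∧<⇒≢m∸1∸ (earlier<total x true up-x cx) (earlier<total y false up-y cy)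
           (sym m≡total+total) (trans (sym (label-true x cx)) (trans e (label-false y cy)))
    ... | inj₂ cx | inj₁ cy = λ e → <∧<⇒≢m∸1∸ (earlier<total y true up-y cy) (earlier<total x false up-x cx)
           (sym m≡total+total) (trans (sym (label-true y cy)) (trans (sym e) (label-false x cx)))

    label-injective : ∀ x y → Upper x → Upper y → label x ≡ label y → x ≡ y
    label-injective x y up-x up-y e with ℕP.<-cmp (pos x) (pos y)
    ... | tri< x<y _ _ = ⊥-elim (label-≢ x y up-x up-y x<y e)
    ... | tri≈ _ x≡y _ = pos-injective x≡y
    ... | tri> _ _ y<x = ⊥-elim (label-≢ y x up-y up-x y<x (sym e))

    label-root : label r ≡ 0
    label-root = trans (label-true r (cong evenᵇ depth-root))
                   (count-≡0 (EarlierOfColour? true r) (λ y (_ , _ , y<r) → root-first y y<r))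

    n≡2m : n ≡ 2 * m
    n≡2m = begin
      n                                   ≡⟨ sym (count-complement Upper?) ⟩
      m + count (λ y → ¬? (Upper? y))     ≡⟨ cong (m +_) lower≡upper ⟩
      m + m                               ≡⟨ cong (m +_) (sym (ℕP.+-identityʳ m)) ⟩
      2 * m                               ∎
      where
      open ≡-Reasoning
      lower≡upper : count (λ y → ¬? (Upper? y)) ≡ m
      lower≡upper = trans (count-cong (λ y → ¬? (Upper? y)) (λ y → Upper? (π y))
                             (¬Upper⇒Upper-π) (λ y up-π up → Upper⇒¬Upper-π y up up-π))
                          (count-permute Upper? π π-involutive)

    -- t = n - 1 = 2m - 1 is odd; upper vertices get even values, lower ones odd.

    t : ℕ
    t = n ∸ 1

    m≡1+[m∸1] : m ≡ suc (m ∸ 1)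
    m≡1+[m∸1] = sym (ℕP.suc-pred m {{>-nonZero 1≤m}})

    t≡1+2[m∸1] : t ≡ suc (2 * (m ∸ 1))
    t≡1+2[m∸1] = cong (_∸ 1) (trans n≡2m (trans (cong (2 *_) m≡1+[m∸1]) (ℕP.*-suc 2 (m ∸ 1))))

    2∤t : ¬ 2 ∣ t
    2∤t 2∣t = 2∤1+2k (m ∸ 1) (subst (2 ∣_) t≡1+2[m∸1] 2∣t)

    t<n : t < n
    t<n = subst (t <_) (ℕP.suc-pred n {{>-nonZero (subst (1 ≤_) (sym n≡2m) (ℕP.≤-trans 1≤m (ℕP.m≤n*m m 2)))}})
            (ℕP.n<1+n t)

    2*label≤t : ∀ x → Upper x → 2 * label x ≤ t
    2*label≤t x up = subst (2 * label x ≤_) (sym t≡1+2[m∸1])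
      (ℕP.m≤n⇒m≤1+n (ℕP.*-monoʳ-≤ 2 (ℕP.<⇒≤pred (label<m x up))))

    value′ : ∀ x → Dec (Upper x) → ℕ
    value′ x (yes _) = 2 * label x
    value′ x (no _)  = t ∸ 2 * label (π x)

    value : Fin n → ℕ
    value x = value′ x (Upper? x)

    value-upper : ∀ x → Upper x → value x ≡ 2 * label x
    value-upper x up with Upper? x
    ... | yes _  = refl
    ... | no ¬up = ⊥-elim (¬up up)

    value-lower : ∀ x → ¬ Upper x → value x ≡ t ∸ 2 * label (π x)
    value-lower x ¬up with Upper? x
    ... | yes up = ⊥-elim (¬up up)
    ... | no _   = refl

    value<n : ∀ x → value x < n
    value<n x with Upper? x
    ... | yes up = ℕP.≤-<-trans (2*label≤t x up) t<n
    ... | no _   = ℕP.≤-<-trans (ℕP.m∸n≤m t (2 * label (π x))) t<n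

    value-matched : ∀ x → value x + value (π x) ≡ t
    value-matched x with Upper? x
    ... | yes up = trans (cong (2 * label x +_) (trans (value-lower (π x) (Upper⇒¬Upper-π x up))
                                                      (cong (λ z → t ∸ 2 * label z) (π-involutive x))))
                         (ℕP.m+[n∸m]≡n (2*label≤t x up))
    ... | no ¬up = trans (cong (t ∸ 2 * label (π x) +_) (value-upper (π x) (¬Upper⇒Upper-π x ¬up)))
                         (ℕP.m∸n+n≡m (2*label≤t (π x) (¬Upper⇒Upper-π x ¬up)))

    value-root : value r ≡ 0
    value-root = trans (value-upper r Upper-root) (cong (2 *_) label-root)

    2*+2*≢t : ∀ a b → 2 * a + 2 * b ≢ t
    2*+2*≢t a b e = 2∤t (subst (2 ∣_) e (∣m∣n⇒∣m+n (m∣m*n a) (m∣m*n b)))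

    value-injective : ∀ x y → value x ≡ value y → x ≡ y
    value-injective x y e = by-cases (Upper? x) (Upper? y)
      where
      by-cases : Dec (Upper x) → Dec (Upper y) → x ≡ y
      by-cases (yes up-x) (yes up-y) = label-injective x y up-x up-y
        (ℕP.*-cancelˡ-≡ _ _ 2 (trans (sym (value-upper x up-x)) (trans e (value-upper y up-y))))
      by-cases (no ¬up-x) (no ¬up-y) = trans (sym (π-involutive x)) (trans (cong π πx≡πy) (π-involutive y))
        where
        πx≡πy : π x ≡ π y
        πx≡πy = label-injective (π x) (π y) (¬Upper⇒Upper-π x ¬up-x) (¬Upper⇒Upper-π y ¬up-y)
          (ℕP.*-cancelˡ-≡ _ _ 2 (ℕP.∸-cancelˡ-≡ (2*label≤t (π x) (¬Upper⇒Upper-π x ¬up-x))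
                                                (2*label≤t (π y) (¬Upper⇒Upper-π y ¬up-y))
             (trans (sym (value-lower x ¬up-x)) (trans e (value-lower y ¬up-y)))))
      by-cases (yes up-x) (no ¬up-y) = ⊥-elim (2*+2*≢t (label x) (label (π y))
        (trans (cong (_+ 2 * label (π y)) (trans (sym (value-upper x up-x)) (trans e (value-lower y ¬up-y))))
               (ℕP.m∸n+n≡m (2*label≤t (π y) (¬Upper⇒Upper-π y ¬up-y)))))
      by-cases (no ¬up-x) (yes up-y) = ⊥-elim (2*+2*≢t (label y) (label (π x))
        (trans (cong (_+ 2 * label (π x)) (trans (sym (value-upper y up-y)) (trans (sym e) (value-lower x ¬up-x))))
               (ℕP.m∸n+n≡m (2*label≤t (π x) (¬Upper⇒Upper-π x ¬up-x)))))

    edgeValue : Fin n → ℕ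
    edgeValue c = ∣ value c - value (parent c) ∣

    edgeValue-upper : ∀ c → Upper c → c ≢ r → edgeValue c ≡ 2 * (m ∸ rank c)
    edgeValue-upper c up c≢r =
      trans (cong₂ ∣_-_∣ (value-upper c up) (value-upper (parent c) (Upper-parent c up c≢r)))
            (trans (sym (ℕP.*-distribˡ-∣-∣ 2 (label c) (label (parent c)))) (cong (2 *_) (label-edge c up c≢r)))

    edgeValue-lower : ∀ c → ¬ Upper c → edgeValue c ≡ ∣ t - 2 * (2 * label (parent c)) ∣
    edgeValue-lower c ¬up =
      trans (cong₂ ∣_-_∣ (trans (value-lower c ¬up) (cong (λ z → t ∸ 2 * label z) (sym (proj₂ (¬Upper⇒ ¬up)))))
                         (value-upper (parent c) up-p))
            (∣m∸n-n∣≡∣m-2n∣ t _ (2*label≤t (parent c) up-p))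
      where
      up-p : Upper (parent c)
      up-p = Upper-parent-of-lower c ¬up

    edgeValue-injective : ∀ c₁ c₂ → c₁ ≢ r → c₂ ≢ r → edgeValue c₁ ≡ edgeValue c₂ → c₁ ≡ c₂
    edgeValue-injective c₁ c₂ c₁≢r c₂≢r e = by-cases (Upper? c₁) (Upper? c₂)
      where
      even≢odd : ∀ {c c′} → Upper c → c ≢ r → ¬ Upper c′ → edgeValue c ≢ edgeValue c′
      even≢odd {c} {c′} up c≢r ¬up′ e′ = 2∤t (∣∣m-n∣∧∣n⇒∣m t (2 * (2 * label (parent c′)))
        (subst (2 ∣_) (trans (sym (edgeValue-upper c up c≢r)) (trans e′ (edgeValue-lower c′ ¬up′)))
          (m∣m*n (m ∸ rank c)))
        (m∣m*n (2 * label (parent c′))))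
      by-cases : Dec (Upper c₁) → Dec (Upper c₂) → c₁ ≡ c₂
      by-cases (yes up₁) (yes up₂) = rank-injective c₁ c₂ up₁ up₂
        (ℕP.∸-cancelˡ-≡ (ℕP.<⇒≤ (rank<m c₁ up₁)) (ℕP.<⇒≤ (rank<m c₂ up₂))
          (ℕP.*-cancelˡ-≡ _ _ 2 (trans (sym (edgeValue-upper c₁ up₁ c₁≢r)) (trans e (edgeValue-upper c₂ up₂ c₂≢r)))))
      by-cases (no ¬up₁) (no ¬up₂)
        with ∣m-a∣≡∣m-b∣ t _ _ (trans (sym (edgeValue-lower c₁ ¬up₁)) (trans e (edgeValue-lower c₂ ¬up₂)))
      ... | inj₁ 4h₁≡4h₂ = trans (sym (π-involutive c₁)) (trans (cong π πc₁≡πc₂) (π-involutive c₂))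
        where
        πc₁≡πc₂ : π c₁ ≡ π c₂
        πc₁≡πc₂ = trans (sym (proj₂ (¬Upper⇒ ¬up₁))) (trans (label-injective (parent c₁) (parent c₂)
                    (Upper-parent-of-lower c₁ ¬up₁) (Upper-parent-of-lower c₂ ¬up₂)
                    (ℕP.*-cancelˡ-≡ _ _ 2 (ℕP.*-cancelˡ-≡ _ _ 2 4h₁≡4h₂))) (proj₂ (¬Upper⇒ ¬up₂)))
      ... | inj₂ 4h₁+4h₂≡2t = ⊥-elim (2*+2*≢t (label (parent c₁)) (label (parent c₂))
              (ℕP.*-cancelˡ-≡ _ _ 2 (trans (ℕP.*-distribˡ-+ 2 (2 * label (parent c₁)) (2 * label (parent c₂))) 4h₁+4h₂≡2t)))
      by-cases (yes up₁) (no ¬up₂) = ⊥-elim (even≢odd up₁ c₁≢r ¬up₂ e)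
      by-cases (no ¬up₁) (yes up₂) = ⊥-elim (even≢odd up₂ c₂≢r ¬up₁ (sym e))

    labelling : Fin n → Fin n
    labelling x = fromℕ< (value<n x)

    toℕ-labelling : ∀ x → toℕ (labelling x) ≡ value x
    toℕ-labelling x = FinP.toℕ-fromℕ< (value<n x)

    labelling-injective : Injective _≡_ _≡_ labelling
    labelling-injective {x} {y} e = value-injective x y
      (trans (sym (toℕ-labelling x)) (trans (cong toℕ e) (toℕ-labelling y)))

    ∣value-value∣ : ∀ a b → Adj G a b →
      (a ≢ r × parent a ≡ b × ∣ value a - value b ∣ ≡ edgeValue a) ⊎
      (b ≢ r × parent b ≡ a × ∣ value a - value b ∣ ≡ edgeValue b)
    ∣value-value∣ a b ab with Adj⇒parent a b ab
    ... | inj₁ (a≢r , refl) = inj₁ (a≢r , refl , refl)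
    ... | inj₂ (b≢r , refl) = inj₂ (b≢r , refl , ℕP.∣-∣-comm (value a) (value b))

    edge-labels-distinct : ∀ a b x y → Adj G a b → Adj G x y →
      ∣ toℕ (labelling a) - toℕ (labelling b) ∣ ≡ ∣ toℕ (labelling x) - toℕ (labelling y) ∣ →
      (a ≡ x × b ≡ y) ⊎ (a ≡ y × b ≡ x)
    edge-labels-distinct a b x y ab xy e
      rewrite toℕ-labelling a | toℕ-labelling b | toℕ-labelling x | toℕ-labelling y
      with ∣value-value∣ a b ab | ∣value-value∣ x y xy
    ... | inj₁ (a≢r , refl , e₁) | inj₁ (x≢r , refl , e₂) with edgeValue-injective a x a≢r x≢r (trans (sym e₁) (trans e e₂))
    ...   | refl = inj₁ (refl , refl)
    edge-labels-distinct a b x y ab xy e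
      | inj₁ (a≢r , refl , e₁) | inj₂ (y≢r , refl , e₂) with edgeValue-injective a y a≢r y≢r (trans (sym e₁) (trans e e₂))
    ...   | refl = inj₂ (refl , refl)
    edge-labels-distinct a b x y ab xy e
      | inj₂ (b≢r , refl , e₁) | inj₁ (x≢r , refl , e₂) with edgeValue-injective b x b≢r x≢r (trans (sym e₁) (trans e e₂))
    ...   | refl = inj₂ (refl , refl)
    edge-labels-distinct a b x y ab xy e
      | inj₂ (b≢r , refl , e₁) | inj₂ (y≢r , refl , e₂) with edgeValue-injective b y b≢r y≢r (trans (sym e₁) (trans e e₂))
    ...   | refl = inj₁ (refl , refl)

    labelling-stronglyGraceful : (M : Fin n → Fin n → Set) → (∀ x y → M x y → y ≡ π x) →
      StronglyGraceful G M labelling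
    labelling-stronglyGraceful M M⇒π =
      ((labelling-injective , injective⇒surjective labelling labelling-injective) , edge-labels-distinct) ,
      λ x y mxy → trans (cong₂ _+_ (toℕ-labelling x) (trans (toℕ-labelling y) (cong value (M⇒π x y mxy))))
                        (value-matched x)

    labelling-root : toℕ (labelling r) ≡ 0
    labelling-root = trans (toℕ-labelling r) value-root

-- Reflected labellings

∣m∸a-m∸b∣≡∣a-b∣ : ∀ m a b → a ≤ m → b ≤ m → ∣ (m ∸ a) - (m ∸ b) ∣ ≡ ∣ a - b ∣
∣m∸a-m∸b∣≡∣a-b∣ m a b a≤m b≤m = begin
  ∣ (m ∸ a) - (m ∸ b) ∣                 ≡⟨ sym (ℕP.∣m+n-m+o∣≡∣n-o∣ (a + b) (m ∸ a) (m ∸ b)) ⟩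
  ∣ a + b + (m ∸ a) - a + b + (m ∸ b) ∣ ≡⟨ cong₂ ∣_-_∣ a+b+[m∸a]≡m+b a+b+[m∸b]≡m+a ⟩
  ∣ m + b - m + a ∣                     ≡⟨ ℕP.∣m+n-m+o∣≡∣n-o∣ m b a ⟩
  ∣ b - a ∣                             ≡⟨ ℕP.∣-∣-comm b a ⟩
  ∣ a - b ∣                             ∎
  where
  open ≡-Reasoning
  a+b+[m∸a]≡m+b : a + b + (m ∸ a) ≡ m + b
  a+b+[m∸a]≡m+b = trans (cong (_+ (m ∸ a)) (ℕP.+-comm a b)) (trans (ℕP.+-assoc b a (m ∸ a))
                    (trans (cong (b +_) (ℕP.m+[n∸m]≡n a≤m)) (ℕP.+-comm b m)))
  a+b+[m∸b]≡m+a : a + b + (m ∸ b) ≡ m + a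
  a+b+[m∸b]≡m+a = trans (ℕP.+-assoc a b (m ∸ b)) (trans (cong (a +_) (ℕP.m+[n∸m]≡n b≤m)) (ℕP.+-comm a m))

toℕ-opposite : ∀ {n} (i : Fin n) → toℕ (opposite i) ≡ n ∸ 1 ∸ toℕ i
toℕ-opposite {n} i = trans (FinP.opposite-prop i) (sym (ℕP.∸-+-assoc n 1 (toℕ i)))

toℕ≤n∸1 : ∀ {n} (i : Fin n) → toℕ i ≤ n ∸ 1
toℕ≤n∸1 i = ℕP.<⇒≤pred (FinP.toℕ<n i)

module _ {n} (G : Graph n) (M : Fin n → Fin n → Set) (f : Fin n → Fin n) where

  StronglyGraceful-opposite : StronglyGraceful G M f → StronglyGraceful G M (opposite ∘′ f)
  StronglyGraceful-opposite (((f-inj , _) , f-edges) , f-matched) =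
    ((g-inj , injective⇒surjective g g-inj) , g-edges) , g-matched
    where
    g : Fin n → Fin n
    g = opposite ∘′ f
    g-inj : Injective _≡_ _≡_ g
    g-inj {x} {y} e = f-inj (trans (sym (FinP.opposite-involutive (f x)))
                               (trans (cong opposite e) (FinP.opposite-involutive (f y))))
    ∣g-g∣ : ∀ u v → ∣ toℕ (g u) - toℕ (g v) ∣ ≡ ∣ toℕ (f u) - toℕ (f v) ∣
    ∣g-g∣ u v = trans (cong₂ ∣_-_∣ (toℕ-opposite (f u)) (toℕ-opposite (f v)))
                      (∣m∸a-m∸b∣≡∣a-b∣ (n ∸ 1) _ _ (toℕ≤n∸1 (f u)) (toℕ≤n∸1 (f v)))
    g-edges : ∀ u v x y → Adj G u v → Adj G x y →
      ∣ toℕ (g u) - toℕ (g v) ∣ ≡ ∣ toℕ (g x) - toℕ (g y) ∣ → (u ≡ x × v ≡ y) ⊎ (u ≡ y × v ≡ x)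
    g-edges u v x y uv xy e = f-edges u v x y uv xy (trans (sym (∣g-g∣ u v)) (trans e (∣g-g∣ x y)))
    g-matched : ∀ x y → M x y → toℕ (g x) + toℕ (g y) ≡ n ∸ 1
    g-matched x y mxy = begin
      toℕ (g x) + toℕ (g y)                             ≡⟨ cong₂ _+_ (toℕ-opposite (f x)) (toℕ-opposite (f y)) ⟩
      (n ∸ 1 ∸ toℕ (f x)) + (n ∸ 1 ∸ toℕ (f y))         ≡⟨ cong₂ _+_ (cong (_∸ toℕ (f x)) (sym s))
                                                                     (cong (_∸ toℕ (f y)) (sym s)) ⟩
      (fx + fy ∸ fx) + (fx + fy ∸ fy)                   ≡⟨ cong₂ _+_ (ℕP.m+n∸m≡n fx fy) (ℕP.m+n∸n≡m fx fy) ⟩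
      fy + fx                                           ≡⟨ ℕP.+-comm fy fx ⟩
      fx + fy                                           ≡⟨ s ⟩
      n ∸ 1                                             ∎
      where
      open ≡-Reasoning
      fx fy : ℕ
      fx = toℕ (f x)
      fy = toℕ (f y)
      s : fx + fy ≡ n ∸ 1
      s = f-matched x y mxy

  opposite-partner-zero : ∀ x y → toℕ (f x) + toℕ (f y) ≡ n ∸ 1 → toℕ (f x) ≡ 0 → toℕ (opposite (f y)) ≡ 0
  opposite-partner-zero x y s fx≡0 = trans (toℕ-opposite (f y))
    (trans (cong (_∸ toℕ (f y)) (sym s)) (trans (cong (λ z → z + toℕ (f y) ∸ toℕ (f y)) fx≡0) (ℕP.n∸n≡0 (toℕ (f y)))))

module SpineRooted {n} (G : Graph n) (acyclic : Acyclic G) (r : Fin n) (R : List (Fin n))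
  (spine-IsPath : IsPath G (r ∷ R)) where
  open import Data.List.Membership.DecPropositional (_≟_ {n}) using (_∈?_)
  open import Relation.Binary.PropositionalEquality using (setoid)
  open import Data.List.Relation.Binary.Permutation.Setoid.Properties (setoid (Fin n))
    using (Unique-resp-↭; ↭-reverse)
  open import Data.List.Relation.Binary.Permutation.Setoid (setoid (Fin n)) using (↭-sym)

  spine : List (Fin n)
  spine = r ∷ R

  data Near (x : Fin n) : Set where
    on-spine  : x ∈ spine → Near x
    one-step  : ∀ w → w ∈ spine → x ∉ spine → Adj G x w → Near x
    two-steps : ∀ y w → w ∈ spine → x ∉ spine → y ∉ spine → Adj G x y → Adj G y w → Near x

  DistLE⇒Near : ∀ v w → w ∈ spine → DistLE G v w 2 → Near v
  DistLE⇒Near v w w∈ (_ , _ , here) = on-spine w∈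
  DistLE⇒Near v w w∈ (_ , _ , step vw here) with v ∈? spine
  ... | yes v∈ = on-spine v∈
  ... | no v∉  = one-step w w∈ v∉ vw
  DistLE⇒Near v w w∈ (_ , _ , step {w = y} vy (step yw here)) with v ∈? spine | y ∈? spine
  ... | yes v∈ | _     = on-spine v∈
  ... | no v∉  | yes y∈ = one-step y y∈ v∉ vy
  ... | no v∉  | no y∉  = two-steps y w w∈ v∉ y∉ vy yw
  DistLE⇒Near v w w∈ (_ , s≤s (s≤s ()) , step _ (step _ (step _ _)))

  spineTail : ∀ {x} → x ∈ spine → List (Fin n)
  spineTail x∈ = reverse (proj₁ (∈-∃++ x∈))

  spineTail-IsPath : ∀ {x} (x∈ : x ∈ spine) → IsPath G (x ∷ spineTail x∈)
  spineTail-IsPath {x} x∈ with ∈-∃++ x∈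
  ... | p₁ , p₂ , e = subst (IsPath G) (ListP.reverse-++ p₁ (x ∷ []))
                        (Chain-reverse G (p₁ ++ x ∷ []) (proj₁ P) ,
                         Unique-resp-↭ (↭-sym (↭-reverse (p₁ ++ x ∷ []))) (proj₂ P))
    where
    P : IsPath G (p₁ ++ x ∷ [])
    P = IsPath-++⁻ˡ G p₁ p₂ (subst (IsPath G) e spine-IsPath)

  spineTail⊆spine : ∀ {x} (x∈ : x ∈ spine) {z} → z ∈ spineTail x∈ → z ∈ spine
  spineTail⊆spine {x} x∈ {z} z∈ with ∈-∃++ x∈
  ... | p₁ , p₂ , e = subst (z ∈_) (sym e) (∈-++⁺ˡ {xs = p₁} (AnyP.reverse⁻ z∈))

  spineTail-ends : ∀ {x} (x∈ : x ∈ spine) → lastFrom x (spineTail x∈) ≡ r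
  spineTail-ends {x} x∈ with ∈-∃++ x∈
  ... | []     , _ , e = sym (ListP.∷-injectiveˡ e)
  ... | s ∷ p₁ , _ , e = trans (cong (lastFrom x) (ListP.unfold-reverse s p₁))
                          (trans (lastFrom-∷ʳ x (reverse p₁) s) (sym (ListP.∷-injectiveˡ e)))

  spineTail-position : ∀ {x} (x∈ : x ∈ spine) →
    Σ (List (Fin n)) λ p₁ → Σ (List (Fin n)) λ p₂ → spine ≡ p₁ ++ x ∷ p₂ × length (spineTail x∈) ≡ length p₁
  spineTail-position x∈ with ∈-∃++ x∈
  ... | p₁ , p₂ , e = p₁ , p₂ , e , ListP.length-reverse p₁

  pathToRoot : ∀ {x} → Near x → List (Fin n)
  pathToRoot (on-spine x∈)              = spineTail x∈
  pathToRoot (one-step w w∈ _ _)        = w ∷ spineTail w∈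
  pathToRoot (two-steps y w w∈ _ _ _ _) = y ∷ w ∷ spineTail w∈

  pathToRoot-IsPath : ∀ {x} (nx : Near x) → IsPath G (x ∷ pathToRoot nx)
  pathToRoot-IsPath (on-spine x∈) = spineTail-IsPath x∈
  pathToRoot-IsPath {x} (one-step w w∈ x∉ xw) =
    (xw , proj₁ (spineTail-IsPath w∈)) , Unique-∷ x∉w∷ (proj₂ (spineTail-IsPath w∈))
    where
    x∉w∷ : x ∉ w ∷ spineTail w∈
    x∉w∷ (here refl) = x∉ w∈
    x∉w∷ (there x∈)  = x∉ (spineTail⊆spine w∈ x∈)
  pathToRoot-IsPath {x} (two-steps y w w∈ x∉ y∉ xy yw) =
    (xy , yw , proj₁ (spineTail-IsPath w∈)) , Unique-∷ x∉y∷ (Unique-∷ y∉w∷ (proj₂ (spineTail-IsPath w∈)))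
    where
    y∉w∷ : y ∉ w ∷ spineTail w∈
    y∉w∷ (here refl) = y∉ w∈
    y∉w∷ (there y∈)  = y∉ (spineTail⊆spine w∈ y∈)
    x∉y∷ : x ∉ y ∷ w ∷ spineTail w∈
    x∉y∷ (here refl)         = irrefl G xy
    x∉y∷ (there (here refl)) = x∉ w∈
    x∉y∷ (there (there x∈))  = x∉ (spineTail⊆spine w∈ x∈)

  pathToRoot-ends : ∀ {x} (nx : Near x) → lastFrom x (pathToRoot nx) ≡ r
  pathToRoot-ends (on-spine x∈)              = spineTail-ends x∈
  pathToRoot-ends (one-step w w∈ _ _)        = spineTail-ends w∈
  pathToRoot-ends (two-steps _ w w∈ _ _ _ _) = spineTail-ends w∈

  module WithNear (near : ∀ x → Near x) where

    rootPath : Fin n → List (Fin n)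
    rootPath x = pathToRoot (near x)

    open RootedTree G acyclic r rootPath (λ x → pathToRoot-IsPath (near x)) (λ x → pathToRoot-ends (near x))
      using (parent; depth; rootPath-parent)

    spine-parent : ∀ x → x ∈ spine → x ≢ r → parent x ∈ spine
    spine-parent x x∈ x≢r = on-spine⇒ (near x) (subst (parent x ∈_) (sym (rootPath-parent x x≢r)) (here refl))
      where
      on-spine⇒ : (nx : Near x) → parent x ∈ pathToRoot nx → parent x ∈ spine
      on-spine⇒ (on-spine x∈′)            = spineTail⊆spine x∈′
      on-spine⇒ (one-step _ _ x∉ _)       = ⊥-elim (x∉ x∈)
      on-spine⇒ (two-steps _ _ _ x∉ _ _ _) = ⊥-elim (x∉ x∈)

    spine-position : ∀ x → x ∈ spine →
      Σ (List (Fin n)) λ p₁ → Σ (List (Fin n)) λ p₂ → spine ≡ p₁ ++ x ∷ p₂ × depth x ≡ length p₁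
    spine-position x x∈ = by-near (near x)
      where
      by-near : (nx : Near x) →
        Σ (List (Fin n)) λ p₁ → Σ (List (Fin n)) λ p₂ → spine ≡ p₁ ++ x ∷ p₂ × length (pathToRoot nx) ≡ length p₁
      by-near (on-spine x∈′)             = spineTail-position x∈′
      by-near (one-step _ _ x∉ _)        = ⊥-elim (x∉ x∈)
      by-near (two-steps _ _ _ x∉ _ _ _) = ⊥-elim (x∉ x∈)

    spine-depth-injective : ∀ x y → x ∈ spine → y ∈ spine → depth x ≡ depth y → x ≡ y
    spine-depth-injective x y x∈ y∈ e with spine-position x x∈ | spine-position y y∈
    ... | p₁ , p₂ , e₁ , l₁ | q₁ , q₂ , e₂ , l₂ =
      ∷-injective-at-length p₁ p₂ q₁ q₂ (trans (sym e₁) e₂) (trans (sym l₁) (trans e l₂))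

    near-spine : ∀ x → x ≢ r → parent x ∈ spine ⊎ parent (parent x) ∈ spine
    near-spine x x≢r = by-near (near x) refl
      where
      by-near : (nx : Near x) → near x ≡ nx → parent x ∈ spine ⊎ parent (parent x) ∈ spine
      by-near (on-spine x∈) _ = inj₁ (spine-parent x x∈ x≢r)
      by-near (one-step w w∈ _ _) e = inj₁ (subst (_∈ spine) (sym (cong (firstOr x ∘′ pathToRoot) e)) w∈)
      by-near (two-steps y w w∈ _ _ _ _) e = inj₂ (subst (_∈ spine) (sym pp≡w) w∈)
        where
        p∷rootPath-p : parent x ∷ rootPath (parent x) ≡ y ∷ w ∷ spineTail w∈
        p∷rootPath-p = trans (sym (rootPath-parent x x≢r)) (cong pathToRoot e)
        pp≡w : parent (parent x) ≡ w
        pp≡w = cong (firstOr (parent x)) (ListP.∷-injectiveʳ p∷rootPath-p)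

module EndEdgeMatching {n} (T : Graph n) (acyclic : Acyclic T)
  (M : Fin n → Fin n → Set) (M-perfect : IsPerfectMatching T M) (M⇔EndEdge : ∀ u v → M u v ⇔ EndEdge T u v) where

  π : Fin n → Fin n
  π x = proj₁ (proj₂ (proj₂ M-perfect) x)

  M-π : ∀ x → M x (π x)
  M-π x = proj₁ (proj₂ (proj₂ (proj₂ M-perfect) x))

  M⇒≡π : ∀ x y → M x y → y ≡ π x
  M⇒≡π x y = proj₂ (proj₂ (proj₂ (proj₂ M-perfect) x)) y

  π-involutive : ∀ x → π (π x) ≡ x
  π-involutive x = sym (M⇒≡π (π x) x (proj₁ (proj₂ M-perfect) x (π x) (M-π x)))

  π-adj : ∀ x → Adj T x (π x)
  π-adj x = proj₁ M-perfect x (π x) (M-π x)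

  π-leaf : ∀ x → Leaf T x ⊎ Leaf T (π x)
  π-leaf x = proj₂ (Equivalence.to (M⇔EndEdge x (π x)) (M-π x))

  stronglyGraceful-rooted : (r : Fin n) (R : List (Fin n)) (spine-IsPath : IsPath T (r ∷ R)) →
    (∀ v → SpineRooted.Near T acyclic r R spine-IsPath v) →
    (w₁ w₂ : Fin n) → Adj T r w₁ → Adj T r w₂ → w₁ ≢ w₂ →
    Σ (Fin n → Fin n) λ f → StronglyGraceful T M f × toℕ (f r) ≡ 0
  stronglyGraceful-rooted r R spine-IsPath near w₁ w₂ r-w₁ r-w₂ w₁≢w₂ =
    labelling , labelling-stronglyGraceful M M⇒≡π , labelling-root
    where
    open SpineRooted T acyclic r R spine-IsPath
    open WithNear near
    open Contraction T acyclic r rootPath (λ x → pathToRoot-IsPath (near x)) (λ x → pathToRoot-ends (near x))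
      π π-involutive π-adj π-leaf w₁ w₂ r-w₁ r-w₂ w₁≢w₂
    open Caterpillar spine (here refl) spine-parent spine-depth-injective near-spine

KDominating-∷ : ∀ {n} (G : Graph n) {k x Q} → KDominating G k Q → KDominating G k (x ∷ Q)
KDominating-∷ G dom v with dom v
... | w , w∈ , d = w , there w∈ , d

-- Longest 2-dominating paths

module LongestDominatingPath {n} (T : Graph n) (acyclic : Acyclic T)
  (M : Fin n → Fin n → Set) (M-perfect : IsPerfectMatching T M) (M⇔EndEdge : ∀ u v → M u v ⇔ EndEdge T u v)
  (v₀ v₁ v₂ : Fin n) (rest : List (Fin n))
  (P-IsPath : IsPath T (v₀ ∷ v₁ ∷ v₂ ∷ rest))
  (P-dominating : KDominating T 2 (v₀ ∷ v₁ ∷ v₂ ∷ rest))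
  (P-longest : ∀ Q → IsPath T Q → KDominating T 2 Q → length Q ≤ length (v₀ ∷ v₁ ∷ v₂ ∷ rest)) where

  open Tree T acyclic
  open EndEdgeMatching T acyclic M M-perfect M⇔EndEdge
  open import Data.List.Membership.DecPropositional (_≟_ {n}) using (_∈?_)

  P : List (Fin n)
  P = v₀ ∷ v₁ ∷ v₂ ∷ rest

  v₀v₁ : Adj T v₀ v₁
  v₀v₁ = proj₁ (proj₁ P-IsPath)

  v₁v₂ : Adj T v₁ v₂
  v₁v₂ = proj₁ (proj₂ (proj₁ P-IsPath))

  v₀≢v₂ : v₀ ≢ v₂
  v₀≢v₂ e = Unique[x∷xs]⇒x∉xs (proj₂ P-IsPath) (there (here e))

  no-longer : ∀ Q → IsPath T Q → KDominating T 2 Q → length P < length Q → ⊥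
  no-longer Q Q-IsPath Q-dominating P<Q = ℕP.<-irrefl refl (ℕP.<-≤-trans P<Q (P-longest Q Q-IsPath Q-dominating))

  -- otherwise P could be extended at v₀
  v₀-leaf : ∀ x → Adj T v₀ x → x ≡ v₁
  v₀-leaf x v₀x with x ≟ v₁
  ... | yes x≡v₁ = x≡v₁
  ... | no x≢v₁ with x ∈? P
  ...   | yes (here x≡v₀)         = ⊥-elim (irrefl T (subst (Adj T v₀) x≡v₀ v₀x))
  ...   | yes (there (here x≡v₁)) = ⊥-elim (x≢v₁ x≡v₁)
  ...   | yes (there (there x∈))  = ⊥-elim (no-chord P-IsPath x∈ (Graph.sym T v₀x))
  ...   | no x∉ = ⊥-elim (no-longer (x ∷ P) ((Graph.sym T v₀x , proj₁ P-IsPath) , Unique-∷ x∉ (proj₂ P-IsPath))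
                            (KDominating-∷ T P-dominating) ℕP.≤-refl)

  DistLE-v₀⇒DistLE-v₁ : ∀ v → DistLE T v v₀ 2 → DistLE T v v₁ 2
  DistLE-v₀⇒DistLE-v₁ v (_ , _ , here)                   = 1 , s≤s z≤n , step v₀v₁ here
  DistLE-v₀⇒DistLE-v₁ v (_ , _ , step vv₀ here)          = 0 , z≤n , subst (λ z → Walk T z v₁ 0) (sym (v₀-leaf v (Graph.sym T vv₀))) here
  DistLE-v₀⇒DistLE-v₁ v (_ , _ , step vy (step yv₀ here)) = 1 , s≤s z≤n , step (subst (Adj T v) (v₀-leaf _ (Graph.sym T yv₀)) vy) here
  DistLE-v₀⇒DistLE-v₁ v (_ , s≤s (s≤s ()) , step _ (step _ (step _ _)))

  π-v₁ : π v₁ ≡ v₀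
  π-v₁ = sym (M⇒≡π v₁ v₀ (Equivalence.from (M⇔EndEdge v₁ v₀) (Graph.sym T v₀v₁ , inj₂ (v₁ , v₀v₁ , v₀-leaf))))

  -- A third neighbour x of v₁ would give the longer dominating path π x x v₁ v₂ …
  v₁-neighbours : ∀ x → Adj T v₁ x → x ≡ v₀ ⊎ x ≡ v₂
  v₁-neighbours x v₁x with x ≟ v₀ | x ≟ v₂
  ... | yes x≡v₀ | _        = inj₁ x≡v₀
  ... | no _     | yes x≡v₂ = inj₂ x≡v₂
  ... | no x≢v₀  | no x≢v₂ with x ∈? P
  ...   | yes (here x≡v₀)                 = ⊥-elim (x≢v₀ x≡v₀)
  ...   | yes (there (here x≡v₁))         = ⊥-elim (irrefl T (subst (Adj T v₁) x≡v₁ v₁x))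
  ...   | yes (there (there (here x≡v₂))) = ⊥-elim (x≢v₂ x≡v₂)
  ...   | yes (there (there (there x∈)))  = ⊥-elim (no-chord (IsPath-tail T P-IsPath) x∈ (Graph.sym T v₁x))
  ...   | no x∉ = ⊥-elim (no-longer (π x ∷ x ∷ v₁ ∷ v₂ ∷ rest) Q-IsPath Q-dominating ℕP.≤-refl)
    where
    x-IsPath : IsPath T (x ∷ v₁ ∷ v₂ ∷ rest)
    x-IsPath = (Graph.sym T v₁x , proj₂ (proj₁ P-IsPath)) , Unique-∷ (x∉ ∘′ there) (Unique-tail (proj₂ P-IsPath))
    πx∉ : π x ∉ x ∷ v₁ ∷ v₂ ∷ rest
    πx∉ (here πx≡x)          = irrefl T (subst (Adj T x) πx≡x (π-adj x))
    πx∉ (there (here πx≡v₁)) = x≢v₀ (trans (sym (π-involutive x)) (trans (cong π πx≡v₁) π-v₁))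
    πx∉ (there (there πx∈))  = no-chord x-IsPath πx∈ (Graph.sym T (π-adj x))
    Q-IsPath : IsPath T (π x ∷ x ∷ v₁ ∷ v₂ ∷ rest)
    Q-IsPath = (Graph.sym T (π-adj x) , proj₁ x-IsPath) , Unique-∷ πx∉ (proj₂ x-IsPath)
    Q-dominating : KDominating T 2 (π x ∷ x ∷ v₁ ∷ v₂ ∷ rest)
    Q-dominating v with P-dominating v
    ... | w , here w≡v₀ , d = v₁ , there (there (here refl)) ,
                              DistLE-v₀⇒DistLE-v₁ v (subst (λ q → DistLE T v q 2) w≡v₀ d)
    ... | w , there w∈ , d  = w , there (there w∈) , d

  module Spine₁ = SpineRooted T acyclic v₁ (v₂ ∷ rest) (IsPath-tail T P-IsPath)
  module Spine₂ = SpineRooted T acyclic v₂ rest (IsPath-tail T (IsPath-tail T P-IsPath))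

  near₁ : ∀ v → Spine₁.Near v
  near₁ v with P-dominating v
  ... | w , here w≡v₀ , d = Spine₁.DistLE⇒Near v v₁ (here refl)
                              (DistLE-v₀⇒DistLE-v₁ v (subst (λ q → DistLE T v q 2) w≡v₀ d))
  ... | w , there w∈ , d  = Spine₁.DistLE⇒Near v w w∈ d

  v₀∉spine₂ : v₀ ∉ v₂ ∷ rest
  v₀∉spine₂ v₀∈ = Unique[x∷xs]⇒x∉xs (proj₂ P-IsPath) (there v₀∈)

  v₁∉spine₂ : v₁ ∉ v₂ ∷ rest
  v₁∉spine₂ = Unique[x∷xs]⇒x∉xs (Unique-tail (proj₂ P-IsPath))

  DistLE-v₁⇒Near₂ : ∀ v → DistLE T v v₁ 2 → Spine₂.Near v
  DistLE-v₁⇒Near₂ v (_ , _ , here) = Spine₂.one-step v₂ (here refl) v₁∉spine₂ v₁v₂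
  DistLE-v₁⇒Near₂ v (_ , _ , step vv₁ here) with v₁-neighbours v (Graph.sym T vv₁)
  ... | inj₁ refl  = Spine₂.two-steps v₁ v₂ (here refl) v₀∉spine₂ v₁∉spine₂ v₀v₁ v₁v₂
  ... | inj₂ v≡v₂  = Spine₂.on-spine (here v≡v₂)
  DistLE-v₁⇒Near₂ v (_ , _ , step {w = y} vy (step yv₁ here)) with v₁-neighbours y (Graph.sym T yv₁)
  ... | inj₁ refl = subst Spine₂.Near (sym (v₀-leaf v (Graph.sym T vy)))
                      (Spine₂.one-step v₂ (here refl) v₁∉spine₂ v₁v₂)
  ... | inj₂ refl = Spine₂.DistLE⇒Near v v₂ (here refl) (1 , s≤s z≤n , step vy here)
  DistLE-v₁⇒Near₂ v (_ , s≤s (s≤s ()) , step _ (step _ (step _ _)))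

  near₂ : ∀ v → Spine₂.Near v
  near₂ v with P-dominating v
  ... | w , here w≡v₀ , d         = DistLE-v₁⇒Near₂ v (DistLE-v₀⇒DistLE-v₁ v (subst (λ q → DistLE T v q 2) w≡v₀ d))
  ... | w , there (here w≡v₁) , d = DistLE-v₁⇒Near₂ v (subst (λ q → DistLE T v q 2) w≡v₁ d)
  ... | w , there (there w∈) , d  = Spine₂.DistLE⇒Near v w w∈ d

  labelling₁ : Σ (Fin n → Fin n) λ f → StronglyGraceful T M f × toℕ (f v₁) ≡ 0
  labelling₁ = stronglyGraceful-rooted v₁ (v₂ ∷ rest) (IsPath-tail T P-IsPath) near₁
                 v₀ v₂ (Graph.sym T v₀v₁) v₁v₂ v₀≢v₂

  labelling₂ : ∀ u₂ → M v₂ u₂ → Σ (Fin n → Fin n) λ f → StronglyGraceful T M f × toℕ (f v₂) ≡ 0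
  labelling₂ u₂ M-v₂u₂ = stronglyGraceful-rooted v₂ rest (IsPath-tail T (IsPath-tail T P-IsPath)) near₂
                           v₁ u₂ (Graph.sym T v₁v₂) (proj₁ M-perfect v₂ u₂ M-v₂u₂) v₁≢u₂
    where
    v₁≢u₂ : v₁ ≢ u₂
    v₁≢u₂ refl = v₀≢v₂ (trans (sym π-v₁) (sym (M⇒≡π v₁ v₂ (proj₁ (proj₂ M-perfect) v₂ v₁ M-v₂u₂))))

  M-v₁v₀ : M v₁ v₀
  M-v₁v₀ = subst (M v₁) π-v₁ (M-π v₁)

theorem4 : (n : ℕ) → 4 ≤ n → (T : Graph n) → IsTree T → Lobster T →
    (M : Fin n → Fin n → Set) → IsPerfectMatching T M →
    (∀ u v → M u v ⇔ EndEdge T u v) →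
    (v₀ v₁ v₂ : Fin n) → (rest : List (Fin n)) →
    IsPath T (v₀ ∷ v₁ ∷ v₂ ∷ rest) →
    KDominating T 2 (v₀ ∷ v₁ ∷ v₂ ∷ rest) →
    (∀ Q → IsPath T Q → KDominating T 2 Q → length Q ≤ length (v₀ ∷ v₁ ∷ v₂ ∷ rest)) →
    (u₂ : Fin n) → M v₂ u₂ →
    Σ (Fin n → Fin n) λ f → Σ (Fin n → Fin n) λ f₁ →
    Σ (Fin n → Fin n) λ f₂ → Σ (Fin n → Fin n) λ f₃ →
    (StronglyGraceful T M f × toℕ (f v₀) ≡ 0) ×
    (StronglyGraceful T M f₁ × toℕ (f₁ v₁) ≡ 0) ×
    (StronglyGraceful T M f₂ × toℕ (f₂ v₂) ≡ 0) ×
    (StronglyGraceful T M f₃ × toℕ (f₃ u₂) ≡ 0)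
theorem4 n _ T (_ , acyclic) _ M M-perfect M⇔EndEdge v₀ v₁ v₂ rest P-IsPath P-dominating P-longest u₂ M-v₂u₂ =
  opposite ∘′ f₁ , f₁ , f₂ , opposite ∘′ f₂ ,
  (StronglyGraceful-opposite T M f₁ f₁-sg , opposite-partner-zero T M f₁ v₁ v₀ (proj₂ f₁-sg v₁ v₀ M-v₁v₀) f₁-v₁) ,
  (f₁-sg , f₁-v₁) ,
  (f₂-sg , f₂-v₂) ,
  (StronglyGraceful-opposite T M f₂ f₂-sg , opposite-partner-zero T M f₂ v₂ u₂ (proj₂ f₂-sg v₂ u₂ M-v₂u₂) f₂-v₂)
  where
  open LongestDominatingPath T acyclic M M-perfect M⇔EndEdge v₀ v₁ v₂ rest P-IsPath P-dominating P-longest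
  f₁ f₂ : Fin n → Fin n
  f₁ = proj₁ labelling₁
  f₂ = proj₁ (labelling₂ u₂ M-v₂u₂)
  f₁-sg : StronglyGraceful T M f₁
  f₁-sg = proj₁ (proj₂ labelling₁)
  f₂-sg : StronglyGraceful T M f₂
  f₂-sg = proj₁ (proj₂ (labelling₂ u₂ M-v₂u₂))
  f₁-v₁ : toℕ (f₁ v₁) ≡ 0
  f₁-v₁ = proj₂ (proj₂ labelling₁)
  f₂-v₂ : toℕ (f₂ v₂) ≡ 0
  f₂-v₂ = proj₂ (proj₂ (labelling₂ u₂ M-v₂u₂))
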